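{- Let $n\ge 1$ and $0\le k\le n$, and let $w,w'\in\mathcal{W}^{(k)}_n$. Then $w$ covers $w'$ in the Bruhat order (i.e. $w'\le w$ and $\ell(w)=\ell(w')+1$) if and only if $w,w'$ is a pair of type B1, B2, B3 or B4.
   Context: The hyperoctahedral group $\mathcal{W}_n$ is the group of signed permutations: bijections $w$ of $\{ -n,\dots,-1,0,1,\dots,n\}$ with $w(-i)=-w(i)$ for all $i$; a bar denotes a negative sign, $\overline{a}=-a$. We write $w$ in one-line notation $w(1)\,w(2)\cdots w(n)$. $\mathcal{W}_n$ is a Coxeter group generated by $s_0$ (which changes the sign of the entry in position 1 of the one-line notation) and $s_i$, $1\le i\le n-1$ (which swaps the entries in positions $i$ and $i+1$); $\ell(w)$ denotes the Coxeter length with respect to $\{s_0,\dots,s_{n-1}\}$, and $\le$ denotes the Bruhat order ($w'\le w$ iff some, equivalently every, reduced word of $w$ contains a subword that is a reduced word for $w'$). We say $w$ covers $w'$ if $w'\le w$ and $\ell(w)=\ell(w')+1$. $\mathcal{W}^{(k)}_n$ (the set of $k$-Grassmannian signed permutations, the minimal-length coset representatives of $\mathcal{W}_n$ modulo the parabolic subgroup generated by all $s_i$ with $i\ne k$) is the set of $w\in\mathcal{W}_n$ whose one-line notation has the form $w=u_1\cdots u_k\,|\,\overline{\lambda_r}\cdots\overline{\lambda_1}\,v_1\cdots v_{n-k-r}$ for some $r\ge 0$, with $0<u_1<\dots<u_k$, $0<\lambda_1<\dots<\lambda_r$, $0<v_1<\dots<v_{n-k-r}$ (the bar "|" after position $k$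 is only a visual separator). We call the $u_i$ the $u$'s, the $\lambda_i$ the $\lambda$'s, the $v_i$ the $v$'s of $w$. For $w,w'\in\mathcal{W}^{(k)}_n$: - $w,w'$ is a pair of type B1 if $\lambda_1=1$ for $w$ (i.e. the entry $\overline{1}$ occurs in $w$) and $w'$ is obtained from $w$ by replacing the entry $\overline{1}$ by $1$ (in the same position). - $w,w'$ is a pair of type B2 if there is an integer $a>0$ such that $a$ is one of the $\lambda$'s of $w$ (entry $\overline{a}$) and $a-1$ is one of the $v$'s of $w$, and $w'$ is obtained from $w$ by replacing the entry $\overline{a}$ by $\overline{a-1}$ and the entry $a-1$ by $a$ (each in its own position). - $w,w'$ is a pair of type B3 if there are integers $a>x>0$ such that $a=u_p$ is one of the $u$'s of $w$ and $a-x$ is one of the $v$'s of $w$, and $w'$ is obtained from $w$ by swapping the entries $a$ and $a-x$. - $w,w'$ is a pair of type B4 if there are integers $a>x>0$ such that $a-x=u_p$ is one of the $u$'s of $w$ and $a$ is one of the $\lambda$'s of $w$ (entry $\overline{a}$), and $w'$ is obtained from $w$ by replacing the entry $a-x$ by $a$ and the entry $\overline{a}$ by $\overline{a-x}$ (each in its own position). -}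

module Defs where

open import Data.Nat using (ℕ; zero; suc; _≤_; _<_; _∸_)
open import Data.Integer as ℤ using (ℤ; +_; -_; ∣_∣)
open import Data.Fin using (Fin; zero; suc; toℕ; inject₁)
open import Data.Vec using (Vec; lookup; tabulate; _[_]≔_; updateAt; toList)
open import Data.List using (List; []; _∷_; foldl; length; map; upTo; _++_; reverse)
open import Data.List.Relation.Binary.Sublist.Propositional using (_⊆_)
open import Data.List.Relation.Binary.Permutation.Propositional using (_↭_)
open import Data.List.Relation.Unary.All using (All)
open import Data.List.Relation.Unary.Linked using (Linked)
open import Data.Product using (Σ; _×_; ∃; ∃-syntax)
open import Data.Sum using (_⊎_)
open import Relation.Binary.PropositionalEquality using (_≡_)

-- A signed permutation w ∈ 𝒲ₙ is represented by its one-line notation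
-- w(1) ⋯ w(n) as a vector of integers; positions are 0-based (Fin n),
-- i.e. Fin-position i is the paper's position i+1.
OneLine : ℕ → Set
OneLine n = Vec ℤ n

IsSignedPerm : ∀ {n} → OneLine n → Set
IsSignedPerm {n} w = map ∣_∣ (toList w) ↭ map suc (upTo n)

identity : ∀ n → OneLine n
identity n = tabulate (λ i → + suc (toℕ i))

swapAt : ∀ {n} → Fin n → Fin n → OneLine n → OneLine n
swapAt i j w = (w [ i ]≔ lookup w j) [ j ]≔ lookup w i

-- Coxeter generators: index zero is s₀, index (suc j) is s_{j+1}.
Gen : ℕ → Set
Gen n = Fin n

-- right multiplication w ↦ w·s (acts on positions of the one-line notation):
-- s₀ changes the sign of the entry in position 1,
-- s_i swaps the entries in positions i and i+1 (1-based).
act : ∀ {n} → OneLine n → Gen n → OneLine n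
act {suc m} w zero    = updateAt w zero -_
act {suc m} w (suc j) = swapAt (inject₁ j) (suc j) w

eval : ∀ {n} → List (Gen n) → OneLine n
eval {n} ws = foldl act (identity n) ws

Reduced : ∀ {n} → List (Gen n) → Set
Reduced {n} ws = ∀ (vs : List (Gen n)) → eval vs ≡ eval ws → length ws ≤ length vs

HasLength : ∀ {n} → OneLine n → ℕ → Set
HasLength {n} w m = Σ (List (Gen n)) λ ws → Reduced ws × eval ws ≡ w × length ws ≡ m

_≤B_ : ∀ {n} → OneLine n → OneLine n → Set
_≤B_ {n} w' w = Σ (List (Gen n)) λ ws → Reduced ws × eval ws ≡ w ×
                 Σ (List (Gen n)) λ vs → vs ⊆ ws × Reduced vs × eval vs ≡ w'

Covers : ∀ {n} → OneLine n → OneLine n → Set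
Covers w w' = w' ≤B w × ∃[ m ] (HasLength w' m × HasLength w (suc m))

PosIncreasing : List ℕ → Set
PosIncreasing xs = All (0 <_) xs × Linked _<_ xs

-- 𝒲⁽ᵏ⁾ₙ : w = u₁⋯u_k | λ̄_r⋯λ̄₁ v₁⋯v_{n-k-r}
IsGrassmannian : ∀ {n} → ℕ → OneLine n → Set
IsGrassmannian k w =
  IsSignedPerm w ×
  Σ (List ℕ) λ us → Σ (List ℕ) λ lams → Σ (List ℕ) λ vs →
    length us ≡ k × PosIncreasing us × PosIncreasing lams × PosIncreasing vs ×
    toList w ≡ map +_ us ++ map (λ l → - (+ l)) (reverse lams) ++ map +_ vs

-- In the following, position p : Fin n lies among the u's iff toℕ p < k,
-- and in the λ/v part iff k ≤ toℕ p; in a Grassmannian element the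
-- negative entries are exactly the λ̄'s and positive entries after
-- position k are exactly the v's.

PairB1 : ∀ {n} → ℕ → OneLine n → OneLine n → Set
PairB1 {n} k w w' = Σ (Fin n) λ p → k ≤ toℕ p × lookup w p ≡ - (+ 1) × w' ≡ w [ p ]≔ + 1

PairB2 : ∀ {n} → ℕ → OneLine n → OneLine n → Set
PairB2 {n} k w w' = Σ ℕ λ a → 0 < a × Σ (Fin n) λ p → Σ (Fin n) λ q →
  k ≤ toℕ p × lookup w p ≡ - (+ a) ×
  k ≤ toℕ q × 0 < a ∸ 1 × lookup w q ≡ + (a ∸ 1) ×
  w' ≡ (w [ p ]≔ - (+ (a ∸ 1))) [ q ]≔ + a

PairB3 : ∀ {n} → ℕ → OneLine n → OneLine n → Set
PairB3 {n} k w w' = Σ ℕ λ a → Σ ℕ λ x → x < a × 0 < x × Σ (Fin n) λ p → Σ (Fin n) λ q →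
  toℕ p < k × lookup w p ≡ + a ×
  k ≤ toℕ q × lookup w q ≡ + (a ∸ x) ×
  w' ≡ swapAt p q w

PairB4 : ∀ {n} → ℕ → OneLine n → OneLine n → Set
PairB4 {n} k w w' = Σ ℕ λ a → Σ ℕ λ x → x < a × 0 < x × Σ (Fin n) λ p → Σ (Fin n) λ q →
  toℕ p < k × lookup w p ≡ + (a ∸ x) ×
  k ≤ toℕ q × lookup w q ≡ - (+ a) ×
  w' ≡ (w [ p ]≔ + a) [ q ]≔ - (+ (a ∸ x))

-- We prove the strong exchange
-- property for "inversions" (reflections t with a visible descent of w at t),
-- and show that the combinatorial count ℓ (negative entries, descent pairs and
-- pairs of negative sum) is the Coxeter length: it changes by at most one per
-- generator, and a descent always exists unless w is the identity.  Together
-- with the fact that deleting a letter from a word multiplies by a reflection,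
-- a Bruhat cover w ⋗ w' is exactly w' = w·t for an inversion t of w with
-- ℓ(w) = ℓ(w') + 1.  For w, w' ∈ 𝒲⁽ᵏ⁾ₙ we then (a) compute ℓ(w) - ℓ(w') = 1
-- for each pair of type B1–B4 by locality of ℓ, and (b) classify the possible
-- inversions t, excluding the others either by the increasing tails of w, w'
-- or by exhibiting three successive inversions from w to w'.
module Submission where

open import Defs

open import Data.Bool using (Bool; true; false; _xor_; _∨_; if_then_else_)
import Data.Bool.Properties as BoolP
open import Data.Empty using (⊥; ⊥-elim)
open import Data.Fin as F using (Fin; zero; suc; toℕ; inject₁)
import Data.Fin.Properties as FP
open import Data.Integer using (ℤ; +_; -_; ∣_∣; -[1+_]; _<_; _≤_; -<+; -<-; +<+; -≤+; -≤-; +≤+)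
import Data.Integer as ℤ
import Data.Integer.Properties as ℤP
open import Data.List using (List; []; _∷_; length; map; applyUpTo; _∷ʳ_; _++_; reverse; foldl)
import Data.List.Properties as LP
open import Data.List.Membership.Propositional using (_∈_)
import Data.List.Membership.Propositional.Properties as MemP
open import Data.List.Relation.Binary.Permutation.Propositional using (_↭_; ↭-sym; ↭-trans; ↭-refl; prep; swap; ↭⇒↭ₛ)
import Data.List.Relation.Binary.Permutation.Propositional.Properties as PermP
import Data.List.Relation.Binary.Permutation.Setoid.Properties as PermS
import Data.List.Relation.Binary.Pointwise as PW
open import Data.List.Relation.Binary.Sublist.Propositional using (_⊆_; []; _∷_; ⊆-refl) renaming (_∷ʳ_ to _∷ˢ_)
import Data.List.Relation.Binary.Sublist.Propositional.Properties as SubP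
open import Data.List.Relation.Unary.All as All using (All; []; _∷_)
import Data.List.Relation.Unary.All.Properties as AllP
open import Data.List.Relation.Unary.AllPairs as AP using (AllPairs; []; _∷_)
import Data.List.Relation.Unary.AllPairs.Properties as APP
open import Data.List.Relation.Unary.Any using (here; there)
open import Data.List.Relation.Unary.Linked using (Linked; []; [-]; _∷_)
import Data.List.Relation.Unary.Linked.Properties as LinkP
import Data.List.Relation.Unary.Sorted.TotalOrder.Properties as SortP
open import Data.List.Relation.Unary.Unique.Propositional using (Unique)
import Data.List.Relation.Unary.Unique.Propositional.Properties as UniqP
open import Data.List.Reverse using (Reverse; reverseView; _∶_∶ʳ_)
open import Data.Nat as ℕ using (ℕ; zero; suc; z≤n; s≤s; _+_; _∸_)
import Data.Nat.Properties as ℕP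
open import Data.Nat.Tactic.RingSolver using (solve-∀)
open import Data.Product using (Σ; _×_; _,_; proj₁; proj₂; ∃)
open import Data.Sum using (_⊎_; inj₁; inj₂)
open import Data.Vec using (Vec; []; _∷_; lookup; tabulate; toList; _[_]≔_; updateAt)
import Data.Vec.Properties as VP
import Data.Vec.Membership.Propositional.Properties as VMP
open import Function using (flip)
open import Function.Bundles using (_⇔_; mk⇔)
open import Relation.Binary using (tri<; tri≈; tri>)
open import Relation.Binary.PropositionalEquality
open import Relation.Binary.PropositionalEquality.Properties using (setoid)
open import Relation.Nullary using (Dec; yes; no; ¬_)
open import Relation.Nullary.Decidable using (⌊_⌋; _×-dec_; _⊎-dec_)

vext : ∀ {A : Set} {n} {u v : Vec A n} → (∀ i → lookup u i ≡ lookup v i) → u ≡ v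
vext {u = u} {v} h = trans (sym (VP.tabulate∘lookup u)) (trans (VP.tabulate-cong h) (VP.tabulate∘lookup v))

swapIx : ∀ {n} → Fin n → Fin n → Fin n → Fin n
swapIx p q i with i F.≟ p
... | yes _ = q
... | no _ with i F.≟ q
...   | yes _ = p
...   | no _ = i

swapIx-p : ∀ {n} (p q : Fin n) → swapIx p q p ≡ q
swapIx-p p q with p F.≟ p
... | yes _ = refl
... | no ne = ⊥-elim (ne refl)

swapIx-q : ∀ {n} (p q : Fin n) → swapIx p q q ≡ p
swapIx-q p q with q F.≟ p
... | yes e = e
... | no _ with q F.≟ q
...   | yes _ = refl
...   | no ne = ⊥-elim (ne refl)

swapIx-other : ∀ {n} (p q i : Fin n) → i ≢ p → i ≢ q → swapIx p q i ≡ i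
swapIx-other p q i a b with i F.≟ p
... | yes e = ⊥-elim (a e)
... | no _ with i F.≟ q
...   | yes e = ⊥-elim (b e)
...   | no _ = refl

swapIx-invol : ∀ {n} (p q i : Fin n) → swapIx p q (swapIx p q i) ≡ i
swapIx-invol p q i with i F.≟ p
... | yes refl = swapIx-q i q
... | no a with i F.≟ q
...   | yes refl = swapIx-p p i
...   | no b = swapIx-other p q i a b

swapIx-comm : ∀ {n} (p q i : Fin n) → swapIx p q i ≡ swapIx q p i
swapIx-comm p q i = go (i F.≟ p) (i F.≟ q)
  where
  go : Dec (i ≡ p) → Dec (i ≡ q) → swapIx p q i ≡ swapIx q p i
  go (yes refl) _ = trans (swapIx-p i q) (sym (swapIx-q q i))
  go (no a) (yes refl) = trans (swapIx-q p i) (sym (swapIx-p i p))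
  go (no a) (no b) = trans (swapIx-other p q i a b) (sym (swapIx-other q p i b a))

swapIx-diag : ∀ {n} (p i : Fin n) → swapIx p p i ≡ i
swapIx-diag p i = go (i F.≟ p)
  where
  go : Dec (i ≡ p) → swapIx p p i ≡ i
  go (yes refl) = swapIx-p i i
  go (no a) = swapIx-other p p i a a

swapIx-injective : ∀ {n} (p q : Fin n) {i j : Fin n} → swapIx p q i ≡ swapIx p q j → i ≡ j
swapIx-injective p q {i} {j} e = trans (sym (swapIx-invol p q i)) (trans (cong (swapIx p q) e) (swapIx-invol p q j))

swapIx-conj : ∀ {n} (f : Fin n → Fin n) → (∀ i → f (f i) ≡ i) → (p q i : Fin n) →
              f (swapIx (f p) (f q) i) ≡ swapIx p q (f i)
swapIx-conj f inv p q i = go (i F.≟ f p) (i F.≟ f q)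
  where
  f-moves : ∀ {a} → i ≢ f a → f i ≢ a
  f-moves {a} ne e = ne (trans (sym (inv i)) (cong f e))
  go : Dec (i ≡ f p) → Dec (i ≡ f q) → f (swapIx (f p) (f q) i) ≡ swapIx p q (f i)
  go (yes refl) _ = trans (cong f (swapIx-p (f p) (f q))) (trans (inv q) (sym (trans (cong (swapIx p q) (inv p)) (swapIx-p p q))))
  go (no a) (yes refl) = trans (cong f (swapIx-q (f p) (f q))) (trans (inv p) (sym (trans (cong (swapIx p q) (inv q)) (swapIx-q p q))))
  go (no a) (no b) = trans (cong f (swapIx-other (f p) (f q) i a b)) (sym (swapIx-other p q (f i) (f-moves a) (f-moves b)))

≟-true : ∀ {n} {i j : Fin n} → i ≡ j → ⌊ i F.≟ j ⌋ ≡ true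
≟-true {i = i} {j} e with i F.≟ j
... | yes _ = refl
... | no ne = ⊥-elim (ne e)

≟-false : ∀ {n} {i j : Fin n} → i ≢ j → ⌊ i F.≟ j ⌋ ≡ false
≟-false {i = i} {j} ne with i F.≟ j
... | yes e = ⊥-elim (ne e)
... | no _ = refl

≟-cong : ∀ {n} {i j k l : Fin n} → (i ≡ j → k ≡ l) → (k ≡ l → i ≡ j) → ⌊ i F.≟ j ⌋ ≡ ⌊ k F.≟ l ⌋
≟-cong {i = i} {j} {k} {l} f g with i F.≟ j | k F.≟ l
... | yes _ | yes _ = refl
... | no _ | no _ = refl
... | yes e | no ne = ⊥-elim (ne (f e))
... | no ne | yes e = ⊥-elim (ne (g e))

-- The reflections of 𝒲ₙ, acting on the right (on positions): changing the sign
-- of one entry, transposing two entries, or transposing two entries and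
-- changing both signs.
data Reflection (n : ℕ) : Set where
  negAt     : Fin n → Reflection n
  transp    : Fin n → Fin n → Reflection n
  negTransp : Fin n → Fin n → Reflection n

positionMap : ∀ {n} → Reflection n → Fin n → Fin n
positionMap (negAt p) i = i
positionMap (transp p q) i = swapIx p q i
positionMap (negTransp p q) i = swapIx p q i

flipsSign : ∀ {n} → Reflection n → Fin n → Bool
flipsSign (negAt p) i = ⌊ i F.≟ p ⌋
flipsSign (transp p q) i = false
flipsSign (negTransp p q) i = ⌊ i F.≟ p ⌋ ∨ ⌊ i F.≟ q ⌋

signIf : Bool → ℤ → ℤ
signIf true x = - x
signIf false x = x

signIf-xor : ∀ a b x → signIf a (signIf b x) ≡ signIf (a xor b) x
signIf-xor true true x = ℤP.neg-involutive x
signIf-xor true false x = refl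
signIf-xor false b x = refl

reflect : ∀ {n} → Reflection n → Vec ℤ n → Vec ℤ n
reflect t w = tabulate (λ i → signIf (flipsSign t i) (lookup w (positionMap t i)))

lookup-reflect : ∀ {n} (t : Reflection n) (w : Vec ℤ n) i →
                 lookup (reflect t w) i ≡ signIf (flipsSign t i) (lookup w (positionMap t i))
lookup-reflect t w i = VP.lookup∘tabulate _ i

module _ {n : ℕ} (w : Vec ℤ n) where
  reflect-negAt-p : ∀ p → lookup (reflect (negAt p) w) p ≡ - lookup w p
  reflect-negAt-p p = trans (lookup-reflect (negAt p) w p) (cong (λ b → signIf b (lookup w p)) (≟-true {i = p} refl))

  reflect-negAt-other : ∀ p i → i ≢ p → lookup (reflect (negAt p) w) i ≡ lookup w i
  reflect-negAt-other p i ne = trans (lookup-reflect (negAt p) w i) (cong (λ b → signIf b (lookup w i)) (≟-false ne))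

  reflect-transp-p : ∀ p q → lookup (reflect (transp p q) w) p ≡ lookup w q
  reflect-transp-p p q = trans (lookup-reflect (transp p q) w p) (cong (lookup w) (swapIx-p p q))

  reflect-transp-q : ∀ p q → lookup (reflect (transp p q) w) q ≡ lookup w p
  reflect-transp-q p q = trans (lookup-reflect (transp p q) w q) (cong (lookup w) (swapIx-q p q))

  reflect-transp-other : ∀ p q i → i ≢ p → i ≢ q → lookup (reflect (transp p q) w) i ≡ lookup w i
  reflect-transp-other p q i a b = trans (lookup-reflect (transp p q) w i) (cong (lookup w) (swapIx-other p q i a b))

  reflect-negTransp-p : ∀ p q → p ≢ q → lookup (reflect (negTransp p q) w) p ≡ - lookup w q
  reflect-negTransp-p p q ne = trans (lookup-reflect (negTransp p q) w p)
    (cong₂ signIf (cong (_∨ ⌊ p F.≟ q ⌋) (≟-true {i = p} refl)) (cong (lookup w) (swapIx-p p q)))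

  reflect-negTransp-q : ∀ p q → p ≢ q → lookup (reflect (negTransp p q) w) q ≡ - lookup w p
  reflect-negTransp-q p q ne = trans (lookup-reflect (negTransp p q) w q)
    (cong₂ signIf (trans (cong (_∨ ⌊ q F.≟ q ⌋) (≟-false (λ e → ne (sym e)))) (≟-true {i = q} refl)) (cong (lookup w) (swapIx-q p q)))

  reflect-negTransp-other : ∀ p q i → i ≢ p → i ≢ q → lookup (reflect (negTransp p q) w) i ≡ lookup w i
  reflect-negTransp-other p q i a b = trans (lookup-reflect (negTransp p q) w i)
    (cong₂ signIf (cong₂ _∨_ (≟-false a) (≟-false b)) (cong (lookup w) (swapIx-other p q i a b)))

  -- The parametrisation is not unique: these identify the redundant names.
  transp-comm : ∀ p q → reflect (transp p q) w ≡ reflect (transp q p) w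
  transp-comm p q = vext λ i → trans (lookup-reflect (transp p q) w i)
    (trans (cong (lookup w) (swapIx-comm p q i)) (sym (lookup-reflect (transp q p) w i)))

  transp-diag : ∀ p → reflect (transp p p) w ≡ w
  transp-diag p = vext λ i → trans (lookup-reflect (transp p p) w i) (cong (lookup w) (swapIx-diag p i))

  negTransp-comm : ∀ p q → reflect (negTransp p q) w ≡ reflect (negTransp q p) w
  negTransp-comm p q = vext λ i → trans (lookup-reflect (negTransp p q) w i)
    (trans (cong₂ signIf (BoolP.∨-comm ⌊ i F.≟ p ⌋ _) (cong (lookup w) (swapIx-comm p q i))) (sym (lookup-reflect (negTransp q p) w i)))

  negTransp-diag : ∀ p → reflect (negTransp p p) w ≡ reflect (negAt p) w
  negTransp-diag p = vext λ i → trans (lookup-reflect (negTransp p p) w i)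
    (trans (cong₂ signIf (BoolP.∨-idem ⌊ i F.≟ p ⌋) (cong (lookup w) (swapIx-diag p i))) (sym (lookup-reflect (negAt p) w i)))

reflect-invol : ∀ {n} (t : Reflection n) w → reflect t (reflect t w) ≡ w
reflect-invol t w = vext λ i → trans (lookup-reflect t (reflect t w) i)
  (trans (cong (signIf (flipsSign t i)) (lookup-reflect t w (positionMap t i)))
  (trans (cong₂ (λ b j → signIf (flipsSign t i) (signIf b (lookup w j))) (flips-invariant t i) (positionMap-invol t i))
  (signIf-invol (flipsSign t i) (lookup w i))))
  where
  signIf-invol : ∀ b x → signIf b (signIf b x) ≡ x
  signIf-invol true x = ℤP.neg-involutive x
  signIf-invol false x = refl
  positionMap-invol : ∀ {n} (t : Reflection n) i → positionMap t (positionMap t i) ≡ i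
  positionMap-invol (negAt p) i = refl
  positionMap-invol (transp p q) i = swapIx-invol p q i
  positionMap-invol (negTransp p q) i = swapIx-invol p q i
  flips-invariant : ∀ {n} (t : Reflection n) i → flipsSign t (positionMap t i) ≡ flipsSign t i
  flips-invariant (negAt p) i = refl
  flips-invariant (transp p q) i = refl
  flips-invariant (negTransp p q) i = trans
    (cong₂ _∨_ (≟-cong (λ e → trans (sym (swapIx-invol p q i)) (trans (cong (swapIx p q) e) (swapIx-p p q)))
                        (λ e → trans (cong (swapIx p q) e) (swapIx-q p q)))
               (≟-cong (λ e → trans (sym (swapIx-invol p q i)) (trans (cong (swapIx p q) e) (swapIx-q p q)))
                        (λ e → trans (cong (swapIx p q) e) (swapIx-p p q))))
    (BoolP.∨-comm ⌊ i F.≟ q ⌋ ⌊ i F.≟ p ⌋)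

genReflection : ∀ {n} → Gen n → Reflection n
genReflection zero = negAt zero
genReflection (suc j) = transp (inject₁ j) (suc j)

lookup-swapAt : ∀ {n} (p q : Fin n) (w : Vec ℤ n) i → lookup (swapAt p q w) i ≡ lookup w (swapIx p q i)
lookup-swapAt p q w i = go (i F.≟ q) (i F.≟ p)
  where
  go : Dec (i ≡ q) → Dec (i ≡ p) → lookup (swapAt p q w) i ≡ lookup w (swapIx p q i)
  go (yes refl) _ = trans (VP.lookup∘update i (w [ p ]≔ lookup w i) (lookup w p)) (cong (lookup w) (sym (swapIx-q p i)))
  go (no a) (yes refl) = trans (VP.lookup∘update′ a (w [ i ]≔ lookup w q) (lookup w i))
                           (trans (VP.lookup∘update i w (lookup w q)) (cong (lookup w) (sym (swapIx-p i q))))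
  go (no a) (no b) = trans (VP.lookup∘update′ a (w [ p ]≔ lookup w q) (lookup w p))
                           (trans (VP.lookup∘update′ b w (lookup w q)) (cong (lookup w) (sym (swapIx-other p q i b a))))

swapAt≡reflect : ∀ {n} (p q : Fin n) (w : Vec ℤ n) → swapAt p q w ≡ reflect (transp p q) w
swapAt≡reflect p q w = vext λ i → trans (lookup-swapAt p q w i) (sym (lookup-reflect (transp p q) w i))

act≡reflect : ∀ {n} (w : Vec ℤ n) (g : Gen n) → act w g ≡ reflect (genReflection g) w
act≡reflect {suc m} w zero = vext go
  where
  go : ∀ i → lookup (updateAt w zero -_) i ≡ lookup (reflect (negAt zero) w) i
  go zero = trans (VP.lookup∘updateAt zero w) (sym (lookup-reflect (negAt zero) w zero))
  go (suc i) = trans (VP.lookup∘updateAt′ (suc i) zero (λ ()) w) (sym (lookup-reflect (negAt zero) w (suc i)))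
act≡reflect {suc m} w (suc j) = swapAt≡reflect (inject₁ j) (suc j) w

act-invol : ∀ {n} (w : Vec ℤ n) g → act (act w g) g ≡ w
act-invol w g = trans (act≡reflect (act w g) g)
  (trans (cong (reflect (genReflection g)) (act≡reflect w g)) (reflect-invol (genReflection g) w))

ρ : ∀ {m} → Fin m → Fin (suc m) → Fin (suc m)
ρ j = swapIx (inject₁ j) (suc j)

lookup-act-suc : ∀ {m} (w : Vec ℤ (suc m)) j i → lookup (act w (suc j)) i ≡ lookup w (ρ j i)
lookup-act-suc w j i = trans (cong (λ v → lookup v i) (act≡reflect w (suc j))) (lookup-reflect (transp (inject₁ j) (suc j)) w i)

lookup-act-suc-ρ : ∀ {m} (w : Vec ℤ (suc m)) j p → lookup (act w (suc j)) (ρ j p) ≡ lookup w p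
lookup-act-suc-ρ w j p = trans (lookup-act-suc w j (ρ j p)) (cong (lookup w) (swapIx-invol _ _ p))

lookup-act-zero : ∀ {m} (w : Vec ℤ (suc m)) i → lookup (act w zero) i ≡ signIf ⌊ i F.≟ zero ⌋ (lookup w i)
lookup-act-zero w i = trans (cong (λ v → lookup v i) (act≡reflect w zero)) (lookup-reflect (negAt zero) w i)

isZero : ∀ {n} → Fin n → Bool
isZero zero = true
isZero (suc _) = false

conjByGen : ∀ {n} → Gen n → Reflection n → Reflection n
conjByGen zero (negAt p) = negAt p
conjByGen zero (transp p q) = if isZero p xor isZero q then negTransp p q else transp p q
conjByGen zero (negTransp p q) = if isZero p xor isZero q then transp p q else negTransp p q
conjByGen (suc j) (negAt p) = negAt (ρ j p)
conjByGen (suc j) (transp p q) = transp (ρ j p) (ρ j q)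
conjByGen (suc j) (negTransp p q) = negTransp (ρ j p) (ρ j q)

conjByGen-invol : ∀ {n} (g : Gen n) t → conjByGen g (conjByGen g t) ≡ t
conjByGen-invol zero (negAt p) = refl
conjByGen-invol zero (transp p q) with isZero p xor isZero q in eq
... | true rewrite eq = refl
... | false rewrite eq = refl
conjByGen-invol zero (negTransp p q) with isZero p xor isZero q in eq
... | true rewrite eq = refl
... | false rewrite eq = refl
conjByGen-invol (suc j) (negAt p) = cong negAt (swapIx-invol _ _ p)
conjByGen-invol (suc j) (transp p q) = cong₂ transp (swapIx-invol _ _ p) (swapIx-invol _ _ q)
conjByGen-invol (suc j) (negTransp p q) = cong₂ negTransp (swapIx-invol _ _ p) (swapIx-invol _ _ q)

reflect-commute : ∀ {n} (r t c : Reflection n) (v : Vec ℤ n) →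
  (∀ i → positionMap t (positionMap r i) ≡ positionMap r (positionMap c i)) →
  (∀ i → flipsSign r i xor flipsSign t (positionMap r i) ≡ flipsSign c i xor flipsSign r (positionMap c i)) →
  reflect r (reflect t v) ≡ reflect c (reflect r v)
reflect-commute r t c v hp hf = vext λ i →
  trans (lookup-reflect r (reflect t v) i)
  (trans (cong (signIf (flipsSign r i)) (lookup-reflect t v (positionMap r i)))
  (trans (signIf-xor (flipsSign r i) (flipsSign t (positionMap r i)) _)
  (trans (cong₂ (λ b j → signIf b (lookup v j)) (hf i) (hp i))
  (trans (sym (signIf-xor (flipsSign c i) (flipsSign r (positionMap c i)) _))
  (trans (cong (signIf (flipsSign c i)) (sym (lookup-reflect r v (positionMap c i))))
  (sym (lookup-reflect c (reflect r v) i)))))))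

xor-move : ∀ a d z → a xor d ≡ z → a ≡ d xor z
xor-move true true false _ = refl
xor-move true false true _ = refl
xor-move false true true _ = refl
xor-move false false false _ = refl

xor-false⇒≡ : ∀ a b → a xor b ≡ false → a ≡ b
xor-false⇒≡ true true _ = refl
xor-false⇒≡ false false _ = refl

module ConjugationByS₀ {m : ℕ} where
  fixes-zero : (p q : Fin (suc m)) → isZero p ≡ isZero q → swapIx p q zero ≡ zero
  fixes-zero zero zero _ = swapIx-p zero zero
  fixes-zero (suc p) (suc q) _ = swapIx-other (suc p) (suc q) zero (λ ()) (λ ())

  isZero-swapIx : (p q i : Fin (suc m)) → swapIx p q zero ≡ zero → ⌊ swapIx p q i F.≟ zero ⌋ ≡ ⌊ i F.≟ zero ⌋
  isZero-swapIx p q i h = ≟-cong (λ e → trans (sym (swapIx-invol p q i)) (trans (cong (swapIx p q) e) h))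
                                 (λ e → trans (cong (swapIx p q) e) h)

  mixed : (p q i : Fin (suc m)) → isZero p xor isZero q ≡ true →
          ⌊ i F.≟ zero ⌋ xor (⌊ i F.≟ p ⌋ ∨ ⌊ i F.≟ q ⌋) ≡ ⌊ swapIx p q i F.≟ zero ⌋
  mixed zero (suc q) i _ = go (i F.≟ zero) (i F.≟ suc q)
    where
    go : Dec (i ≡ zero) → Dec (i ≡ suc q) → ⌊ i F.≟ zero ⌋ xor (⌊ i F.≟ zero ⌋ ∨ ⌊ i F.≟ suc q ⌋) ≡ ⌊ swapIx zero (suc q) i F.≟ zero ⌋
    go (yes refl) _ rewrite swapIx-p zero (suc q) = refl
    go (no a) (yes refl) rewrite swapIx-q zero (suc q) | ≟-false a | ≟-true (refl {x = suc q}) = refl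
    go (no a) (no b) rewrite swapIx-other zero (suc q) i a b | ≟-false a | ≟-false b = refl
  mixed (suc p) zero i _ = go (i F.≟ zero) (i F.≟ suc p)
    where
    go : Dec (i ≡ zero) → Dec (i ≡ suc p) → ⌊ i F.≟ zero ⌋ xor (⌊ i F.≟ suc p ⌋ ∨ ⌊ i F.≟ zero ⌋) ≡ ⌊ swapIx (suc p) zero i F.≟ zero ⌋
    go (yes refl) _ rewrite swapIx-q (suc p) zero = refl
    go (no a) (yes refl) rewrite swapIx-p (suc p) zero | ≟-false a | ≟-true (refl {x = suc p}) = refl
    go (no a) (no b) rewrite swapIx-other (suc p) zero i b a | ≟-false a | ≟-false b = refl

ρ-≟ : ∀ {m} (j : Fin m) (i p : Fin (suc m)) → ⌊ ρ j i F.≟ p ⌋ ≡ ⌊ i F.≟ ρ j p ⌋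
ρ-≟ j i p = ≟-cong (λ e → trans (sym (swapIx-invol _ _ i)) (cong (ρ j) e)) (λ e → trans (cong (ρ j) e) (swapIx-invol _ _ p))

genReflection-reflect : ∀ {n} (g : Gen n) (t : Reflection n) (v : Vec ℤ n) →
  reflect (genReflection g) (reflect t v) ≡ reflect (conjByGen g t) (reflect (genReflection g) v)
genReflection-reflect zero (negAt p) v =
  reflect-commute (negAt zero) (negAt p) (negAt p) v (λ i → refl) (λ i → BoolP.xor-comm ⌊ i F.≟ zero ⌋ ⌊ i F.≟ p ⌋)
genReflection-reflect zero (transp p q) v with isZero p xor isZero q in eq
... | true = reflect-commute (negAt zero) (transp p q) (negTransp p q) v (λ i → refl) λ i →
  trans (BoolP.xor-identityʳ ⌊ i F.≟ zero ⌋) (xor-move ⌊ i F.≟ zero ⌋ (⌊ i F.≟ p ⌋ ∨ ⌊ i F.≟ q ⌋) _ (mixed p q i eq))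
  where open ConjugationByS₀
... | false = reflect-commute (negAt zero) (transp p q) (transp p q) v (λ i → refl) λ i →
  trans (BoolP.xor-identityʳ ⌊ i F.≟ zero ⌋) (sym (isZero-swapIx p q i (fixes-zero p q (xor-false⇒≡ _ _ eq))))
  where open ConjugationByS₀
genReflection-reflect zero (negTransp p q) v with isZero p xor isZero q in eq
... | true = reflect-commute (negAt zero) (negTransp p q) (transp p q) v (λ i → refl) λ i → mixed p q i eq
  where open ConjugationByS₀
... | false = reflect-commute (negAt zero) (negTransp p q) (negTransp p q) v (λ i → refl) λ i →
  trans (BoolP.xor-comm ⌊ i F.≟ zero ⌋ (⌊ i F.≟ p ⌋ ∨ ⌊ i F.≟ q ⌋)) (cong ((⌊ i F.≟ p ⌋ ∨ ⌊ i F.≟ q ⌋) xor_) (sym (isZero-swapIx p q i (fixes-zero p q (xor-false⇒≡ _ _ eq)))))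
  where open ConjugationByS₀
genReflection-reflect (suc j) (negAt p) v =
  reflect-commute (genReflection (suc j)) (negAt p) (negAt (ρ j p)) v (λ i → refl) (λ i → trans (ρ-≟ j i p) (sym (BoolP.xor-identityʳ _)))
genReflection-reflect (suc j) (transp p q) v =
  reflect-commute (genReflection (suc j)) (transp p q) (transp (ρ j p) (ρ j q)) v
    (λ i → sym (swapIx-conj (ρ j) (swapIx-invol _ _) p q i)) (λ i → refl)
genReflection-reflect (suc j) (negTransp p q) v =
  reflect-commute (genReflection (suc j)) (negTransp p q) (negTransp (ρ j p) (ρ j q)) v
    (λ i → sym (swapIx-conj (ρ j) (swapIx-invol _ _) p q i))
    (λ i → trans (cong₂ _∨_ (ρ-≟ j i p) (ρ-≟ j i q)) (sym (BoolP.xor-identityʳ _)))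

act-reflect : ∀ {n} (g : Gen n) (t : Reflection n) (v : Vec ℤ n) → act (reflect t v) g ≡ reflect (conjByGen g t) (act v g)
act-reflect g t v = trans (act≡reflect (reflect t v) g)
  (trans (genReflection-reflect g t v) (cong (reflect (conjByGen g t)) (sym (act≡reflect v g))))

<-neg⇒sum<0 : ∀ {x y : ℤ} → y < - x → x ℤ.+ y < + 0
<-neg⇒sum<0 {x} {y} h = subst (x ℤ.+ y <_) (ℤP.+-inverseʳ x) (ℤP.+-monoʳ-< x h)

sum<0⇒<-neg : ∀ {x y : ℤ} → x ℤ.+ y < + 0 → y < - x
sum<0⇒<-neg {x} {y} h = subst₂ _<_ e (ℤP.+-identityʳ (- x)) (ℤP.+-monoʳ-< (- x) h)
  where
  e : - x ℤ.+ (x ℤ.+ y) ≡ y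
  e = trans (sym (ℤP.+-assoc (- x) x y)) (trans (cong (λ z → z ℤ.+ y) (ℤP.+-inverseˡ x)) (ℤP.+-identityˡ y))

sum<0⇒<-negˡ : ∀ {x y : ℤ} → x ℤ.+ y < + 0 → x < - y
sum<0⇒<-negˡ {x} {y} h = sum<0⇒<-neg (subst (_< + 0) (ℤP.+-comm x y) h)

<⇒neg-sum<0 : ∀ {x y : ℤ} → y < x → - x ℤ.+ y < + 0
<⇒neg-sum<0 {x} {y} h = <-neg⇒sum<0 (subst (y <_) (sym (ℤP.neg-involutive x)) h)

-- t is an inversion of w when w·t is shorter than w: in one-line notation,
-- a negative entry (t = negAt p), a descent pair w(q) < w(p) for p < q
-- (t = transp p q), or two entries of negative sum (t = negTransp p q).
IsInversion : ∀ {n} → Reflection n → Vec ℤ n → Set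
IsInversion (negAt p) w = lookup w p < + 0
IsInversion (transp p q) w = (toℕ p ℕ.< toℕ q × lookup w q < lookup w p) ⊎ (toℕ q ℕ.< toℕ p × lookup w p < lookup w q)
IsInversion (negTransp p q) w = p ≢ q × lookup w p ℤ.+ lookup w q < + 0

ρ-mono : ∀ {m} (j : Fin m) (x y : Fin (suc m)) → toℕ x ℕ.< toℕ y → ¬ (x ≡ inject₁ j × y ≡ suc j) →
         toℕ (ρ j x) ℕ.< toℕ (ρ j y)
ρ-mono {m} j x y lt nab = go (x F.≟ inject₁ j) (x F.≟ suc j) (y F.≟ inject₁ j) (y F.≟ suc j)
  where
  a b : Fin (suc m)
  a = inject₁ j
  b = suc j
  ta : toℕ a ≡ toℕ j
  ta = FP.toℕ-inject₁ j
  a<b : toℕ a ℕ.< suc (toℕ j)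
  a<b = subst (ℕ._< suc (toℕ j)) (sym ta) (ℕP.n<1+n _)
  go : Dec (x ≡ a) → Dec (x ≡ b) → Dec (y ≡ a) → Dec (y ≡ b) → toℕ (ρ j x) ℕ.< toℕ (ρ j y)
  go (yes refl) _ (yes refl) _ = ⊥-elim (ℕP.<-irrefl refl lt)
  go (yes refl) _ (no ya) (yes refl) = ⊥-elim (nab (refl , refl))
  go (yes refl) _ (no ya) (no yb) rewrite swapIx-p a b | swapIx-other a b y ya yb =
     ℕP.≤∧≢⇒< (subst (λ k → suc k ℕ.≤ toℕ y) ta lt) (λ e → yb (FP.toℕ-injective (sym e)))
  go (no xa) (yes refl) (yes refl) _ = ⊥-elim (ℕP.<-asym lt a<b)
  go (no xa) (yes refl) (no ya) (yes refl) = ⊥-elim (ℕP.<-irrefl refl lt)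
  go (no xa) (yes refl) (no ya) (no yb) rewrite swapIx-q a b | swapIx-other a b y ya yb = ℕP.<-trans a<b lt
  go (no xa) (no xb) (yes refl) _ rewrite swapIx-other a b x xa xb | swapIx-p a b = ℕP.<-trans lt a<b
  go (no xa) (no xb) (no ya) (yes refl) rewrite swapIx-other a b x xa xb | swapIx-q a b =
     subst (toℕ x ℕ.<_) (sym ta) (ℕP.≤∧≢⇒< (ℕP.≤-pred lt) (λ e → xa (FP.toℕ-injective (trans e (sym ta)))))
  go (no xa) (no xb) (no ya) (no yb) rewrite swapIx-other a b x xa xb | swapIx-other a b y ya yb = lt

inversion-after-gen : ∀ {n} (g : Gen n) (t : Reflection n) (w : Vec ℤ n) → IsInversion t w →
                      (reflect t w ≡ act w g) ⊎ IsInversion (conjByGen g t) (act w g)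
inversion-after-gen zero (negAt zero) w _ = inj₁ (sym (act≡reflect w zero))
inversion-after-gen zero (negAt (suc p)) w h = inj₂ (subst (_< + 0) (sym (lookup-act-zero w (suc p))) h)
inversion-after-gen zero (transp zero zero) w (inj₁ (lt , _)) = ⊥-elim (ℕP.<-irrefl refl lt)
inversion-after-gen zero (transp zero zero) w (inj₂ (lt , _)) = ⊥-elim (ℕP.<-irrefl refl lt)
inversion-after-gen zero (transp zero (suc q)) w (inj₁ (_ , lt)) =
  inj₂ ((λ ()) , subst₂ (λ a b → a ℤ.+ b < + 0) (sym (lookup-act-zero w zero)) (sym (lookup-act-zero w (suc q))) (<⇒neg-sum<0 lt))
inversion-after-gen zero (transp zero (suc q)) w (inj₂ (() , _))
inversion-after-gen zero (transp (suc p) zero) w (inj₁ (() , _))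
inversion-after-gen zero (transp (suc p) zero) w (inj₂ (_ , lt)) =
  inj₂ ((λ ()) , subst₂ (λ a b → a ℤ.+ b < + 0) (sym (lookup-act-zero w (suc p))) (sym (lookup-act-zero w zero))
                   (subst (_< + 0) (ℤP.+-comm (- lookup w zero) (lookup w (suc p))) (<⇒neg-sum<0 lt)))
inversion-after-gen zero (transp (suc p) (suc q)) w h =
  inj₂ (subst₂ (λ a b → (toℕ (suc p) ℕ.< toℕ (suc q) × b < a) ⊎ (toℕ (suc q) ℕ.< toℕ (suc p) × a < b))
               (sym (lookup-act-zero w (suc p))) (sym (lookup-act-zero w (suc q))) h)
inversion-after-gen zero (negTransp zero zero) w (ne , _) = ⊥-elim (ne refl)
inversion-after-gen zero (negTransp zero (suc q)) w (_ , s) =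
  inj₂ (inj₁ (s≤s z≤n , subst₂ _<_ (sym (lookup-act-zero w (suc q))) (sym (lookup-act-zero w zero)) (sum<0⇒<-neg s)))
inversion-after-gen zero (negTransp (suc p) zero) w (_ , s) =
  inj₂ (inj₂ (s≤s z≤n , subst₂ _<_ (sym (lookup-act-zero w (suc p))) (sym (lookup-act-zero w zero)) (sum<0⇒<-negˡ s)))
inversion-after-gen zero (negTransp (suc p) (suc q)) w (ne , s) =
  inj₂ (ne , subst₂ (λ a b → a ℤ.+ b < + 0) (sym (lookup-act-zero w (suc p))) (sym (lookup-act-zero w (suc q))) s)
inversion-after-gen (suc j) (negAt p) w h = inj₂ (subst (_< + 0) (sym (lookup-act-suc-ρ w j p)) h)
inversion-after-gen (suc j) (negTransp p q) w (ne , s) =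
  inj₂ ((λ e → ne (swapIx-injective _ _ e)) ,
        subst₂ (λ a b → a ℤ.+ b < + 0) (sym (lookup-act-suc-ρ w j p)) (sym (lookup-act-suc-ρ w j q)) s)
inversion-after-gen (suc j) (transp p q) w h
  with ((p F.≟ inject₁ j) ×-dec (q F.≟ suc j)) ⊎-dec ((p F.≟ suc j) ×-dec (q F.≟ inject₁ j))
... | yes (inj₁ (refl , refl)) = inj₁ (sym (act≡reflect w (suc j)))
... | yes (inj₂ (refl , refl)) = inj₁ (trans (transp-comm w p q) (sym (act≡reflect w (suc j))))
... | no other with h
...   | inj₁ (lt , v) = inj₂ (inj₁ (ρ-mono j p q lt (λ e → other (inj₁ e)) ,
                               subst₂ _<_ (sym (lookup-act-suc-ρ w j q)) (sym (lookup-act-suc-ρ w j p)) v))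
...   | inj₂ (lt , v) = inj₂ (inj₂ (ρ-mono j q p lt (λ e → other (inj₂ (proj₂ e , proj₁ e))) ,
                               subst₂ _<_ (sym (lookup-act-suc-ρ w j p)) (sym (lookup-act-suc-ρ w j q)) v))

lookup-identity : ∀ {n} (i : Fin n) → lookup (identity n) i ≡ + suc (toℕ i)
lookup-identity = VP.lookup∘tabulate (λ i → + suc (toℕ i))

identity-has-no-inversion : ∀ {n} (t : Reflection n) → ¬ IsInversion t (identity n)
identity-has-no-inversion (negAt p) h rewrite lookup-identity p = ℤP.<-asym h (ℤ.+<+ (s≤s z≤n))
identity-has-no-inversion (transp p q) (inj₁ (lt , v)) rewrite lookup-identity p | lookup-identity q =
  ℕP.<-asym lt (ℕP.≤-pred (ℤP.drop‿+<+ v))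
identity-has-no-inversion (transp p q) (inj₂ (lt , v)) rewrite lookup-identity p | lookup-identity q =
  ℕP.<-asym lt (ℕP.≤-pred (ℤP.drop‿+<+ v))
identity-has-no-inversion (negTransp p q) (_ , v) rewrite lookup-identity p | lookup-identity q =
  ℤP.<-asym v (ℤ.+<+ (s≤s z≤n))

length-∷ʳ : ∀ {A : Set} (xs : List A) (g : A) → length (xs ∷ʳ g) ≡ suc (length xs)
length-∷ʳ xs g = trans (LP.length-++ xs) (ℕP.+-comm (length xs) 1)

eval-∷ʳ : ∀ {n} (xs : List (Gen n)) g → eval (xs ∷ʳ g) ≡ act (eval xs) g
eval-∷ʳ xs g = LP.foldl-∷ʳ act _ g xs

ExchangeWitness : ∀ {n} → Reflection n → List (Gen n) → Set
ExchangeWitness t ws = Σ _ λ vs → vs ⊆ ws × suc (length vs) ≡ length ws × eval vs ≡ reflect t (eval ws)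

exchange-rev : ∀ {n} (ws : List (Gen n)) → Reverse ws → ∀ t → IsInversion t (eval ws) → ExchangeWitness t ws
exchange-rev .[] Reverse.[] t h = ⊥-elim (identity-has-no-inversion t h)
exchange-rev {n} .(xs ∷ʳ g) (xs ∶ rs ∶ʳ g) t h = go (inversion-after-gen g t w (subst (IsInversion t) ew h))
  where
  w0 : Vec ℤ n
  w0 = eval xs
  w : Vec ℤ n
  w = act w0 g
  ew : eval (xs ∷ʳ g) ≡ w
  ew = eval-∷ʳ xs g
  go : (reflect t w ≡ act w g) ⊎ IsInversion (conjByGen g t) (act w g) → ExchangeWitness t (xs ∷ʳ g)
  go (inj₁ e) = xs , SubP.++⁺ʳ _ ⊆-refl , sym (length-∷ʳ xs g) ,
                sym (trans (cong (reflect t) ew) (trans e (act-invol w0 g)))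
  go (inj₂ h2) with exchange-rev xs rs (conjByGen g t) (subst (IsInversion (conjByGen g t)) (act-invol w0 g) h2)
  ... | vs , sub , len , ev = (vs ∷ʳ g) , SubP.++⁺ sub ⊆-refl ,
        trans (cong suc (length-∷ʳ vs g)) (trans (cong suc len) (sym (length-∷ʳ xs g))) ,
        (begin
          eval (vs ∷ʳ g)                                    ≡⟨ eval-∷ʳ vs g ⟩
          act (eval vs) g                                   ≡⟨ cong (λ v → act v g) ev ⟩
          act (reflect (conjByGen g t) w0) g                ≡⟨ act-reflect g (conjByGen g t) w0 ⟩
          reflect (conjByGen g (conjByGen g t)) w           ≡⟨ cong (λ t' → reflect t' w) (conjByGen-invol g t) ⟩
          reflect t w                                       ≡⟨ cong (reflect t) ew ⟨
          reflect t (eval (xs ∷ʳ g))                        ∎)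
    where open ≡-Reasoning

exchange : ∀ {n} (ws : List (Gen n)) t → IsInversion t (eval ws) → ExchangeWitness t ws
exchange ws = exchange-rev ws (reverseView ws)

indicator : ∀ {P : Set} → Dec P → ℕ
indicator (yes _) = 1
indicator (no _) = 0

indicator-cong : ∀ {P Q : Set} (dp : Dec P) (dq : Dec Q) → (P → Q) → (Q → P) → indicator dp ≡ indicator dq
indicator-cong (yes _) (yes _) f g = refl
indicator-cong (no _) (no _) f g = refl
indicator-cong (yes p) (no nq) f g = ⊥-elim (nq (f p))
indicator-cong (no np) (yes q) f g = ⊥-elim (np (g q))

indicator≤1 : ∀ {P : Set} (d : Dec P) → indicator d ℕ.≤ 1
indicator≤1 (yes _) = s≤s z≤n
indicator≤1 (no _) = z≤n

indicator-yes : ∀ {P : Set} (d : Dec P) → P → indicator d ≡ 1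
indicator-yes (yes _) _ = refl
indicator-yes (no np) p = ⊥-elim (np p)

indicator-no : ∀ {P : Set} (d : Dec P) → ¬ P → indicator d ≡ 0
indicator-no (yes p) np = ⊥-elim (np p)
indicator-no (no _) _ = refl

-- The combinatorial length of a signed permutation in one-line notation:
--   ℓ(w) = #{i : w(i) < 0} + #{i < j : w(j) < w(i)} + #{i < j : w(i) + w(j) < 0}.
-- pairInv x y counts the inversions of type B formed by entries x before y.
pairInv : ℤ → ℤ → ℕ
pairInv x y = indicator (y ℤP.<? x) + indicator (y ℤP.<? - x)

negInv : ℤ → ℕ
negInv x = indicator (x ℤP.<? + 0)

sumOver : ∀ {n} → (ℤ → ℕ) → Vec ℤ n → ℕ
sumOver f [] = 0
sumOver f (x ∷ xs) = f x + sumOver f xs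

ℓ : ∀ {n} → Vec ℤ n → ℕ
ℓ [] = 0
ℓ (x ∷ xs) = negInv x + sumOver (pairInv x) xs + ℓ xs

sumOver-cong : ∀ {n} {f g : ℤ → ℕ} → (∀ y → f y ≡ g y) → (xs : Vec ℤ n) → sumOver f xs ≡ sumOver g xs
sumOver-cong e [] = refl
sumOver-cong e (x ∷ xs) = cong₂ _+_ (e x) (sumOver-cong e xs)

<-neg-swap : ∀ {x y : ℤ} → y < - x → x < - y
<-neg-swap {x} {y} h = subst (_< - y) (ℤP.neg-involutive x) (ℤP.neg-mono-< h)

pairInv-neg : ∀ x y → pairInv (- x) y ≡ pairInv x y
pairInv-neg x y = trans
  (cong (_+_ (indicator (y ℤP.<? - x))) (indicator-cong (y ℤP.<? - (- x)) (y ℤP.<? x)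
     (subst (y <_) (ℤP.neg-involutive x)) (subst (y <_) (sym (ℤP.neg-involutive x)))))
  (ℕP.+-comm (indicator (y ℤP.<? - x)) _)

ℓ-swap-head : ∀ {m} x y (xs : Vec ℤ m) → ℓ (y ∷ x ∷ xs) + indicator (y ℤP.<? x) ≡ ℓ (x ∷ y ∷ xs) + indicator (x ℤP.<? y)
ℓ-swap-head x y xs rewrite indicator-cong (x ℤP.<? - y) (y ℤP.<? - x) <-neg-swap <-neg-swap =
  rearrange (negInv x) (negInv y) (indicator (y ℤP.<? x)) (indicator (x ℤP.<? y)) (indicator (y ℤP.<? - x))
            (sumOver (pairInv x) xs) (sumOver (pairInv y) xs) (ℓ xs)
  where
  rearrange : ∀ nx ny a b c sx sy s → ny + (b + c + sy) + (nx + sx + s) + a ≡ nx + (a + c + sx) + (ny + sy + s) + b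
  rearrange = solve-∀

sumOver-act-suc : ∀ {m} (f : ℤ → ℕ) (j : Fin m) (w : Vec ℤ (suc m)) → sumOver f (act w (suc j)) ≡ sumOver f w
sumOver-act-suc f zero (x ∷ y ∷ xs) = swap-first (f x) (f y) (sumOver f xs)
  where
  swap-first : ∀ a b c → b + (a + c) ≡ a + (b + c)
  swap-first = solve-∀
sumOver-act-suc f (suc j) (x ∷ w) = cong (_+_ (f x)) (sumOver-act-suc f j w)

ℓ-act-suc : ∀ {m} (j : Fin m) (w : Vec ℤ (suc m)) → ℓ (act w (suc j)) ℕ.≤ suc (ℓ w)
ℓ-act-suc zero (x ∷ y ∷ xs) = ℕP.+-cancelʳ-≤ (indicator (y ℤP.<? x)) _ _
  (subst (ℕ._≤ suc (ℓ (x ∷ y ∷ xs)) + indicator (y ℤP.<? x)) (sym (ℓ-swap-head x y xs))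
    (ℕP.≤-trans (ℕP.+-monoʳ-≤ (ℓ (x ∷ y ∷ xs)) (indicator≤1 (x ℤP.<? y)))
                (ℕP.≤-trans (ℕP.≤-reflexive (ℕP.+-comm _ 1)) (ℕP.m≤m+n _ _))))
ℓ-act-suc (suc j) (x ∷ w) rewrite sumOver-act-suc (pairInv x) j w =
  ℕP.≤-trans (ℕP.+-monoʳ-≤ (negInv x + sumOver (pairInv x) w) (ℓ-act-suc j w))
             (ℕP.≤-reflexive (ℕP.+-suc (negInv x + sumOver (pairInv x) w) (ℓ w)))

ℓ-act-zero : ∀ {m} (w : Vec ℤ (suc m)) → ℓ (act w zero) ℕ.≤ suc (ℓ w)
ℓ-act-zero (x ∷ xs) rewrite sumOver-cong (pairInv-neg x) xs =
  ℕP.+-monoˡ-≤ (ℓ xs) (ℕP.+-monoˡ-≤ (sumOver (pairInv x) xs) (ℕP.≤-trans (indicator≤1 (- x ℤP.<? + 0)) (s≤s z≤n)))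

ℓ-act : ∀ {n} (w : Vec ℤ n) (g : Gen n) → ℓ (act w g) ℕ.≤ suc (ℓ w)
ℓ-act {suc m} w zero = ℓ-act-zero w
ℓ-act {suc m} w (suc j) = ℓ-act-suc j w

ℓ-foldl : ∀ {n} (v : Vec ℤ n) (ws : List (Gen n)) → ℓ (foldl act v ws) ℕ.≤ ℓ v + length ws
ℓ-foldl v [] = ℕP.≤-reflexive (sym (ℕP.+-identityʳ (ℓ v)))
ℓ-foldl v (g ∷ ws) = ℕP.≤-trans (ℓ-foldl (act v g) ws)
  (ℕP.≤-trans (ℕP.+-monoˡ-≤ (length ws) (ℓ-act v g)) (ℕP.≤-reflexive (sym (ℕP.+-suc (ℓ v) (length ws)))))

SortedNonneg : ∀ {n} → Vec ℤ n → Set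
SortedNonneg w = (∀ i → + 0 ≤ lookup w i) × (∀ i j → toℕ i ℕ.< toℕ j → lookup w i ≤ lookup w j)

sumOver-zero : ∀ {n} (f : ℤ → ℕ) (xs : Vec ℤ n) → (∀ i → f (lookup xs i) ≡ 0) → sumOver f xs ≡ 0
sumOver-zero f [] h = refl
sumOver-zero f (x ∷ xs) h rewrite h zero = sumOver-zero f xs (λ i → h (suc i))

ℓ-sorted : ∀ {n} (w : Vec ℤ n) → SortedNonneg w → ℓ w ≡ 0
ℓ-sorted [] _ = refl
ℓ-sorted (x ∷ xs) (nn , mono) rewrite indicator-no (x ℤP.<? + 0) (ℤP.≤⇒≯ (nn zero))
  | sumOver-zero (pairInv x) xs (λ i → cong₂ _+_
      (indicator-no (lookup xs i ℤP.<? x) (ℤP.≤⇒≯ (mono zero (suc i) (s≤s z≤n))))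
      (indicator-no (lookup xs i ℤP.<? - x)
         (ℤP.≤⇒≯ (ℤP.≤-trans (ℤP.≤-trans (ℤP.neg-mono-≤ (nn zero)) (nn zero)) (mono zero (suc i) (s≤s z≤n))))))
  = ℓ-sorted xs ((λ i → nn (suc i)) , (λ i j lt → mono (suc i) (suc j) (s≤s lt)))

sorted-identity : ∀ n → SortedNonneg (identity n)
sorted-identity n = (λ i → subst (+ 0 ≤_) (sym (lookup-identity i)) (ℤ.+≤+ z≤n)) ,
  λ i j lt → subst₂ _≤_ (sym (lookup-identity i)) (sym (lookup-identity j)) (ℤ.+≤+ (s≤s (ℕP.<⇒≤ lt)))

ℓ≤length : ∀ {n} (ws : List (Gen n)) → ℓ (eval ws) ℕ.≤ length ws
ℓ≤length {n} ws = subst (λ k → ℓ (eval ws) ℕ.≤ k + length ws) (ℓ-sorted (identity n) (sorted-identity n)) (ℓ-foldl (identity n) ws)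

descent-neg-head : ∀ {m} x (xs : Vec ℤ m) → x < + 0 → suc (ℓ (act (x ∷ xs) zero)) ≡ ℓ (x ∷ xs)
descent-neg-head x xs lt rewrite sumOver-cong (pairInv-neg x) xs | indicator-yes (x ℤP.<? + 0) lt
  | indicator-no (- x ℤP.<? + 0) (λ h → ℤP.<-asym h (ℤP.neg-mono-< lt)) = refl

descent-swap-head : ∀ {m} x y (xs : Vec ℤ m) → y < x → suc (ℓ (y ∷ x ∷ xs)) ≡ ℓ (x ∷ y ∷ xs)
descent-swap-head x y xs lt = trans (ℕP.+-comm 1 (ℓ (y ∷ x ∷ xs))) (trans e (ℕP.+-identityʳ _))
  where
  e : ℓ (y ∷ x ∷ xs) + 1 ≡ ℓ (x ∷ y ∷ xs) + 0
  e = subst₂ (λ a b → ℓ (y ∷ x ∷ xs) + a ≡ ℓ (x ∷ y ∷ xs) + b)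
        (indicator-yes (y ℤP.<? x) lt) (indicator-no (x ℤP.<? y) (ℤP.<-asym lt)) (ℓ-swap-head x y xs)

Descent : ∀ {n} → Vec ℤ n → Set
Descent {n} w = Σ (Gen n) λ g → suc (ℓ (act w g)) ≡ ℓ w

descent-nonneg-head : ∀ {m} (w : Vec ℤ (suc m)) → + 0 ≤ lookup w zero →
                      (Σ (Fin m) λ j → suc (ℓ (act w (suc j))) ≡ ℓ w) ⊎ SortedNonneg w
descent-nonneg-head (x ∷ []) nn = inj₂ ((λ { zero → nn }) , (λ { zero zero () }))
descent-nonneg-head (x ∷ y ∷ xs) nn = by-order (y ℤP.<? x)
  where
  Goal : Set
  Goal = (Σ (Fin _) λ j → suc (ℓ (act (x ∷ y ∷ xs) (suc j))) ≡ ℓ (x ∷ y ∷ xs)) ⊎ SortedNonneg (x ∷ y ∷ xs)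
  extend : x ≤ y → (Σ (Fin _) λ j → suc (ℓ (act (y ∷ xs) (suc j))) ≡ ℓ (y ∷ xs)) ⊎ SortedNonneg (y ∷ xs) → Goal
  by-order : Dec (y < x) → Goal
  by-order (yes lt) = inj₁ (zero , descent-swap-head x y xs lt)
  by-order (no nlt) = extend (ℤP.≮⇒≥ nlt) (descent-nonneg-head (y ∷ xs) (ℤP.≤-trans nn (ℤP.≮⇒≥ nlt)))
  extend _ (inj₁ (j , e)) = inj₁ (suc j ,
    trans (cong (λ k → suc (negInv x + k + ℓ (act (y ∷ xs) (suc j)))) (sumOver-act-suc (pairInv x) j (y ∷ xs)))
    (trans (sym (ℕP.+-suc (negInv x + sumOver (pairInv x) (y ∷ xs)) _)) (cong (_+_ (negInv x + sumOver (pairInv x) (y ∷ xs))) e)))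
  extend x≤y (inj₂ (nn' , mono)) = inj₂ (nnA , monoA)
    where
    nnA : ∀ i → + 0 ≤ lookup (x ∷ y ∷ xs) i
    nnA zero = nn
    nnA (suc i) = nn' i
    monoA : ∀ i j → toℕ i ℕ.< toℕ j → lookup (x ∷ y ∷ xs) i ≤ lookup (x ∷ y ∷ xs) j
    monoA zero zero ()
    monoA zero (suc zero) _ = x≤y
    monoA zero (suc (suc j)) _ = ℤP.≤-trans x≤y (mono zero (suc j) (s≤s z≤n))
    monoA (suc i) zero ()
    monoA (suc i) (suc j) (s≤s lt) = mono i j lt

descent : ∀ {n} (w : Vec ℤ n) → Descent w ⊎ SortedNonneg w
descent [] = inj₂ ((λ ()) , (λ ()))
descent (x ∷ xs) = by-sign (x ℤP.<? + 0)
  where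
  by-sign : Dec (x < + 0) → Descent (x ∷ xs) ⊎ SortedNonneg (x ∷ xs)
  by-sign (yes lt) = inj₁ (zero , descent-neg-head x xs lt)
  by-sign (no nlt) with descent-nonneg-head (x ∷ xs) (ℤP.≮⇒≥ nlt)
  ... | inj₁ (j , e) = inj₁ (suc j , e)
  ... | inj₂ s = inj₂ s

absList : ∀ {n} → Vec ℤ n → List ℕ
absList w = map ∣_∣ (toList w)

absList-act : ∀ {n} (w : Vec ℤ n) g → absList (act w g) ↭ absList w
absList-act {suc m} (x ∷ xs) zero = subst (λ k → (k ∷ absList xs) ↭ absList (x ∷ xs)) (sym (ℤP.∣-i∣≡∣i∣ x)) ↭-refl
absList-act {suc m} w (suc j) = go j w
  where
  go : ∀ {m} (j : Fin m) (w : Vec ℤ (suc m)) → absList (act w (suc j)) ↭ absList w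
  go zero (x ∷ y ∷ xs) = swap ∣ y ∣ ∣ x ∣ ↭-refl
  go (suc j) (x ∷ w) = prep ∣ x ∣ (go j w)

absList-tabulate : ∀ n (f : ℕ → ℕ) → absList (tabulate {n = n} (λ i → + f (toℕ i))) ≡ applyUpTo f n
absList-tabulate zero f = refl
absList-tabulate (suc n) f = cong (f 0 ∷_) (absList-tabulate n (λ k → f (suc k)))

signedPerm-identity : ∀ n → IsSignedPerm (identity n)
signedPerm-identity n = subst (absList (identity n) ↭_) (sym (LP.map-applyUpTo (λ k → k) suc n))
                              (subst (_↭ applyUpTo suc n) (sym (absList-tabulate n suc)) ↭-refl)

signedPerm-foldl : ∀ {n} (v : Vec ℤ n) (ws : List (Gen n)) → IsSignedPerm v → IsSignedPerm (foldl act v ws)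
signedPerm-foldl v [] h = h
signedPerm-foldl v (g ∷ ws) h = signedPerm-foldl (act v g) ws (↭-trans (absList-act v g) h)

signedPerm-eval : ∀ {n} (ws : List (Gen n)) → IsSignedPerm (eval ws)
signedPerm-eval {n} ws = signedPerm-foldl (identity n) ws (signedPerm-identity n)

sorted-absList : ∀ {n} (w : Vec ℤ n) → SortedNonneg w → Linked ℕ._≤_ (absList w)
sorted-absList [] _ = []
sorted-absList (x ∷ []) _ = [-]
sorted-absList (x ∷ y ∷ xs) (nn , mono) =
  abs-mono (nn zero) (mono zero (suc zero) (s≤s z≤n)) ∷
  sorted-absList (y ∷ xs) ((λ i → nn (suc i)) , (λ i j lt → mono (suc i) (suc j) (s≤s lt)))
  where
  abs-mono : ∀ {a b : ℤ} → + 0 ≤ a → a ≤ b → ∣ a ∣ ℕ.≤ ∣ b ∣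
  abs-mono {+ a} {+ b} _ (ℤ.+≤+ le) = le

absList-injective : ∀ {n} (u v : Vec ℤ n) → (∀ i → + 0 ≤ lookup u i) → (∀ i → + 0 ≤ lookup v i) → absList u ≡ absList v → u ≡ v
absList-injective [] [] _ _ _ = refl
absList-injective (x ∷ u) (y ∷ v) nu nv e =
  cong₂ _∷_ (trans (sym (ℤP.0≤i⇒+∣i∣≡i (nu zero))) (trans (cong +_ (LP.∷-injectiveˡ e)) (ℤP.0≤i⇒+∣i∣≡i (nv zero))))
            (absList-injective u v (λ i → nu (suc i)) (λ i → nv (suc i)) (LP.∷-injectiveʳ e))

sorted-signedPerm≡identity : ∀ {n} (w : Vec ℤ n) → SortedNonneg w → IsSignedPerm w → w ≡ identity n
sorted-signedPerm≡identity {n} w s p = absList-injective w (identity n) (proj₁ s) (proj₁ (sorted-identity n))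
  (PW.Pointwise-≡⇒≡ (SortP.↗↭↗⇒≋ ℕP.≤-totalOrder (sorted-absList w s) (sorted-absList (identity n) (sorted-identity n))
     (↭⇒↭ₛ (↭-trans p (↭-sym (signedPerm-identity n))))))

-- Upper bound: following descents, every signed permutation has a word of length ℓ(w).
MinimalWord : ∀ {n} → Vec ℤ n → Set
MinimalWord {n} w = Σ (List (Gen n)) λ ws → eval ws ≡ w × length ws ≡ ℓ w

minimalWord-of : ∀ {n} k (w : Vec ℤ n) → IsSignedPerm w → ℓ w ≡ k → MinimalWord w
minimalWord-of k w p e with descent w
minimalWord-of zero w p e | inj₁ (g , e') = ⊥-elim (ℕP.1+n≢0 (trans e' e))
minimalWord-of (suc k) w p e | inj₁ (g , e')
  with minimalWord-of k (act w g) (↭-trans (absList-act w g) p) (ℕP.suc-injective (trans e' e))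
... | ws , ev , len = ws ∷ʳ g , trans (eval-∷ʳ ws g) (trans (cong (λ v → act v g) ev) (act-invol w g)) ,
                      trans (length-∷ʳ ws g) (trans (cong suc len) e')
minimalWord-of k w p e | inj₂ s = [] , sym (sorted-signedPerm≡identity w s p) , sym (ℓ-sorted w s)

minimalWord : ∀ {n} (w : Vec ℤ n) → IsSignedPerm w → MinimalWord w
minimalWord w p = minimalWord-of (ℓ w) w p refl

reduced-if-length≡ℓ : ∀ {n} (ws : List (Gen n)) → length ws ≡ ℓ (eval ws) → Reduced ws
reduced-if-length≡ℓ ws e vs ev = subst (ℕ._≤ length vs) (sym e) (subst (λ v → ℓ v ℕ.≤ length vs) ev (ℓ≤length vs))

hasLength-ℓ : ∀ {n} (w : Vec ℤ n) → IsSignedPerm w → HasLength w (ℓ w)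
hasLength-ℓ w p with minimalWord w p
... | ws , ev , len = ws , reduced-if-length≡ℓ ws (trans len (cong ℓ (sym ev))) , ev , len

hasLength⇒≡ℓ : ∀ {n} (w : Vec ℤ n) m → HasLength w m → IsSignedPerm w → m ≡ ℓ w
hasLength⇒≡ℓ w m (ws , red , ev , len) p with minimalWord w p
... | us , ev' , len' = trans (sym len) (ℕP.≤-antisym (subst (length ws ℕ.≤_) len' (red us (trans ev' (sym ev))))
                                                     (subst (λ v → ℓ v ℕ.≤ length ws) ev (ℓ≤length ws)))

-- Applying an inversion strictly lowers the length (by the exchange property).
inversion-lowers-ℓ : ∀ {n} (t : Reflection n) (v : Vec ℤ n) → IsInversion t v → IsSignedPerm v →
                     ℓ (reflect t v) ℕ.< ℓ v × IsSignedPerm (reflect t v)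
inversion-lowers-ℓ t v h p with minimalWord v p
... | ws , ev , len with exchange ws t (subst (IsInversion t) (sym ev) h)
...   | vs , _ , lenv , evv = subst₂ ℕ._≤_ (cong (λ u → suc (ℓ u)) e) (trans lenv len) (s≤s (ℓ≤length vs)) ,
                              subst IsSignedPerm e (signedPerm-eval vs)
  where
  e : eval vs ≡ reflect t v
  e = trans evv (cong (reflect t) ev)

lookup-∈ : ∀ {n} (w : Vec ℤ n) i → ∣ lookup w i ∣ ∈ absList w
lookup-∈ (x ∷ w) zero = here refl
lookup-∈ (x ∷ w) (suc i) = there (lookup-∈ w i)

∈-absList : ∀ {n} (w : Vec ℤ n) {m} → m ∈ absList w → ∃ λ i → ∣ lookup w i ∣ ≡ m
∈-absList (x ∷ w) (here e) = zero , sym e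
∈-absList (x ∷ w) (there h) with ∈-absList w h
... | i , e = suc i , e

unique-absList⇒distinct : ∀ {n} (w : Vec ℤ n) → Unique (absList w) → ∀ i j → i ≢ j → ∣ lookup w i ∣ ≢ ∣ lookup w j ∣
unique-absList⇒distinct (x ∷ w) (a ∷ u) zero zero ne = ⊥-elim (ne refl)
unique-absList⇒distinct (x ∷ w) (a ∷ u) zero (suc j) ne = All.lookup a (lookup-∈ w j)
unique-absList⇒distinct (x ∷ w) (a ∷ u) (suc i) zero ne = λ e → All.lookup a (lookup-∈ w i) (sym e)
unique-absList⇒distinct (x ∷ w) (a ∷ u) (suc i) (suc j) ne = unique-absList⇒distinct w u i j (λ e → ne (cong suc e))

abs-distinct : ∀ {n} (w : Vec ℤ n) → IsSignedPerm w → ∀ i j → i ≢ j → ∣ lookup w i ∣ ≢ ∣ lookup w j ∣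
abs-distinct {n} w p = unique-absList⇒distinct w
  (PermS.Unique-resp-↭ (setoid ℕ) (↭⇒↭ₛ (↭-sym p)) (UniqP.map⁺ ℕP.suc-injective (UniqP.upTo⁺ n)))

abs-range : ∀ {n} (w : Vec ℤ n) → IsSignedPerm w → ∀ i → ∃ λ k → k ℕ.< n × ∣ lookup w i ∣ ≡ suc k
abs-range w p i with MemP.∈-map⁻ suc (PermP.∈-resp-↭ p (lookup-∈ w i))
... | k , mem , e = k , MemP.∈-upTo⁻ mem , e

entry-nonzero : ∀ {n} (w : Vec ℤ n) → IsSignedPerm w → ∀ i → lookup w i ≢ + 0
entry-nonzero w p i e with abs-range w p i
... | k , _ , e' = ℕP.0≢1+n (trans (sym (cong ∣_∣ e)) e')

abs-exists : ∀ {n} (w : Vec ℤ n) → IsSignedPerm w → ∀ k → k ℕ.< n → ∃ λ i → ∣ lookup w i ∣ ≡ suc k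
abs-exists w p k lt = ∈-absList w (PermP.∈-resp-↭ (↭-sym p) (MemP.∈-map⁺ suc (MemP.∈-upTo⁺ lt)))

sublist-same-length : ∀ {A : Set} {xs ys : List A} → xs ⊆ ys → length xs ≡ length ys → xs ≡ ys
sublist-same-length [] _ = refl
sublist-same-length (y ∷ˢ r) e = ⊥-elim (ℕP.<-irrefl e (s≤s (SubP.length-mono-≤ r)))
sublist-same-length (refl ∷ r) e = cong (_ ∷_) (sublist-same-length r (ℕP.suc-injective e))

split-deleted : ∀ {A : Set} {vs ws : List A} → vs ⊆ ws → length ws ≡ suc (length vs) →
                Σ (List A) λ a → Σ A λ g → Σ (List A) λ b → ws ≡ a ++ g ∷ b × vs ≡ a ++ b
split-deleted [] ()
split-deleted (y ∷ˢ r) e = [] , y , _ , refl , sublist-same-length r (sym (ℕP.suc-injective e))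
split-deleted (refl ∷ r) e with split-deleted r (ℕP.suc-injective e)
... | a , g , b , e1 , e2 = (_ ∷ a) , g , b , cong (_ ∷_) e1 , cong (_ ∷_) e2

conjByWord : ∀ {n} → List (Gen n) → Reflection n → Reflection n
conjByWord [] t = t
conjByWord (g ∷ b) t = conjByWord b (conjByGen g t)

foldl-reflect : ∀ {n} (b : List (Gen n)) t v → foldl act (reflect t v) b ≡ reflect (conjByWord b t) (foldl act v b)
foldl-reflect [] t v = refl
foldl-reflect (g ∷ b) t v = trans (cong (λ u → foldl act u b) (act-reflect g t v)) (foldl-reflect b (conjByGen g t) (act v g))

deletion-is-reflection : ∀ {n} (a : List (Gen n)) g b →
                         eval (a ++ b) ≡ reflect (conjByWord b (genReflection g)) (eval (a ++ g ∷ b))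
deletion-is-reflection {n} a g b = begin
  eval (a ++ b)                                           ≡⟨ LP.foldl-++ act (identity n) a b ⟩
  foldl act (eval a) b                                    ≡⟨ cong (λ u → foldl act u b) s-cancel ⟨
  foldl act (reflect (genReflection g) (act (eval a) g)) b ≡⟨ foldl-reflect b (genReflection g) (act (eval a) g) ⟩
  reflect t (foldl act (act (eval a) g) b)                ≡⟨ cong (reflect t) (LP.foldl-++ act (identity n) a (g ∷ b)) ⟨
  reflect t (eval (a ++ g ∷ b))                           ∎
  where
  open ≡-Reasoning
  t = conjByWord b (genReflection g)
  s-cancel : reflect (genReflection g) (act (eval a) g) ≡ eval a
  s-cancel = trans (cong (reflect (genReflection g)) (act≡reflect (eval a) g)) (reflect-invol (genReflection g) (eval a))

data InversionReflection {n} (w w' : Vec ℤ n) : Set where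
  byNegAt     : (p : Fin n) → lookup w p < + 0 → w' ≡ reflect (negAt p) w → InversionReflection w w'
  byTransp    : (p q : Fin n) → toℕ p ℕ.< toℕ q → lookup w q < lookup w p →
                w' ≡ reflect (transp p q) w → InversionReflection w w'
  byNegTransp : (p q : Fin n) → toℕ p ℕ.< toℕ q → lookup w p ℤ.+ lookup w q < + 0 →
                w' ≡ reflect (negTransp p q) w → InversionReflection w w'

<⇒≢ : ∀ {n} {p q : Fin n} → toℕ p ℕ.< toℕ q → p ≢ q
<⇒≢ lt refl = ℕP.<-irrefl refl lt

sum≡0⇒≡-neg : ∀ {a b : ℤ} → a ℤ.+ b ≡ + 0 → b ≡ - a
sum≡0⇒≡-neg {a} {b} h = trans (sym (ℤP.+-identityˡ b)) (trans (cong (λ z → z ℤ.+ b) (sym (ℤP.+-inverseˡ a)))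
  (trans (ℤP.+-assoc (- a) a b) (trans (cong (λ z → (- a) ℤ.+ z) h) (ℤP.+-identityʳ (- a)))))

-- If w·t = w' is one shorter than w, then t is an inversion of w: otherwise it
-- would be an inversion of w' and w = w'·t would be shorter than w'.
module ToInversion {n : ℕ} (w w' : Vec ℤ n) (pw : IsSignedPerm w) (pw' : IsSignedPerm w') (len : ℓ w ≡ suc (ℓ w')) where

  not-inversion-of-w' : ∀ t → w' ≡ reflect t w → ¬ IsInversion t w'
  not-inversion-of-w' t e h = ℕP.<-asym
    (subst (ℕ._< ℓ w') (cong ℓ (trans (cong (reflect t) e) (reflect-invol t w))) (proj₁ (inversion-lowers-ℓ t w' h pw')))
    (subst (ℓ w' ℕ.<_) (sym len) (ℕP.n<1+n (ℓ w')))

  caseNegAt : ∀ p → w' ≡ reflect (negAt p) w → InversionReflection w w'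
  caseNegAt p e with ℤP.<-cmp (lookup w p) (+ 0)
  ... | tri< lt _ _ = byNegAt p lt e
  ... | tri≈ _ eq _ = ⊥-elim (entry-nonzero w pw p eq)
  ... | tri> _ _ gt = ⊥-elim (not-inversion-of-w' (negAt p) e
          (subst (_< + 0) (sym (trans (cong (λ v → lookup v p) e) (reflect-negAt-p w p))) (ℤP.neg-mono-< gt)))

  caseTransp : ∀ p q → toℕ p ℕ.< toℕ q → w' ≡ reflect (transp p q) w → InversionReflection w w'
  caseTransp p q lt e with ℤP.<-cmp (lookup w q) (lookup w p)
  ... | tri< l _ _ = byTransp p q lt l e
  ... | tri≈ _ eq _ = ⊥-elim (abs-distinct w pw q p (λ x → <⇒≢ lt (sym x)) (cong ∣_∣ eq))
  ... | tri> _ _ g = ⊥-elim (not-inversion-of-w' (transp p q) e (inj₁ (lt ,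
          subst₂ _<_ (sym (trans (cong (λ v → lookup v q) e) (reflect-transp-q w p q)))
                     (sym (trans (cong (λ v → lookup v p) e) (reflect-transp-p w p q))) g)))

  caseNegTransp : ∀ p q → toℕ p ℕ.< toℕ q → w' ≡ reflect (negTransp p q) w → InversionReflection w w'
  caseNegTransp p q lt e with ℤP.<-cmp (lookup w p ℤ.+ lookup w q) (+ 0)
  ... | tri< l _ _ = byNegTransp p q lt l e
  ... | tri≈ _ eq _ = ⊥-elim (abs-distinct w pw p q (<⇒≢ lt)
          (trans (sym (ℤP.∣-i∣≡∣i∣ (lookup w p))) (cong ∣_∣ (sym (sum≡0⇒≡-neg {lookup w p} {lookup w q} eq)))))
  ... | tri> _ _ g = ⊥-elim (not-inversion-of-w' (negTransp p q) e (<⇒≢ lt , subst (_< + 0) sum' (ℤP.neg-mono-< g)))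
    where
    sum' : - (lookup w p ℤ.+ lookup w q) ≡ lookup w' p ℤ.+ lookup w' q
    sum' = trans (ℤP.neg-distrib-+ (lookup w p) (lookup w q)) (trans (ℤP.+-comm (- lookup w p) (- lookup w q))
             (sym (cong₂ ℤ._+_ (trans (cong (λ v → lookup v p) e) (reflect-negTransp-p w p q (<⇒≢ lt)))
                               (trans (cong (λ v → lookup v q) e) (reflect-negTransp-q w p q (<⇒≢ lt))))))

  asInversion : ∀ t → w' ≡ reflect t w → InversionReflection w w'
  asInversion (negAt p) e = caseNegAt p e
  asInversion (transp p q) e with ℕP.<-cmp (toℕ p) (toℕ q)
  ... | tri< lt _ _ = caseTransp p q lt e
  ... | tri≈ _ eq _ = ⊥-elim (ℕP.<-irrefl (trans (cong ℓ w'≡w) len) (ℕP.n<1+n (ℓ w')))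
    where
    w'≡w : w' ≡ w
    w'≡w = trans e (trans (cong (λ r → reflect (transp r q) w) (FP.toℕ-injective eq)) (transp-diag w q))
  ... | tri> _ _ gt = caseTransp q p gt (trans e (transp-comm w p q))
  asInversion (negTransp p q) e with ℕP.<-cmp (toℕ p) (toℕ q)
  ... | tri< lt _ _ = caseNegTransp p q lt e
  ... | tri≈ _ eq _ = caseNegAt q (trans e (trans (cong (λ r → reflect (negTransp r q) w) (FP.toℕ-injective eq)) (negTransp-diag w q)))
  ... | tri> _ _ gt = caseNegTransp q p gt (trans e (negTransp-comm w p q))

record GrassShape {n} (k : ℕ) (w : Vec ℤ n) : Set where
  field
    u-pos     : ∀ i → toℕ i ℕ.< k → + 0 < lookup w i
    u-incr    : ∀ i j → toℕ i ℕ.< toℕ j → toℕ j ℕ.< k → lookup w i < lookup w j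
    tail-incr : ∀ i j → k ℕ.≤ toℕ i → toℕ i ℕ.< toℕ j → lookup w i < lookup w j

all-reverse : ∀ {A : Set} {P : A → Set} (xs : List A) → All P xs → All P (reverse xs)
all-reverse [] [] = []
all-reverse (x ∷ xs) (px ∷ pxs) = subst (All _) (sym (LP.unfold-reverse x xs)) (AllP.∷ʳ⁺ (all-reverse xs pxs) px)

allPairs-reverse : ∀ {A : Set} {R : A → A → Set} (xs : List A) → AllPairs R xs → AllPairs (flip R) (reverse xs)
allPairs-reverse [] [] = []
allPairs-reverse {R = R} (x ∷ xs) (px ∷ pxs) = subst (AllPairs (flip R)) (sym (LP.unfold-reverse x xs))
  (APP.++⁺ (allPairs-reverse xs pxs) ([] ∷ []) (All.map (λ r → r ∷ []) (all-reverse xs px)))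

allPairs-lookup : ∀ {n} {R : ℤ → ℤ → Set} (w : Vec ℤ n) → AllPairs R (toList w) →
                  ∀ i j → toℕ i ℕ.< toℕ j → R (lookup w i) (lookup w j)
allPairs-lookup (x ∷ w) (a ∷ r) zero (suc j) _ = All.lookup a (VMP.∈-toList⁺ (VMP.∈-lookup j w))
allPairs-lookup (x ∷ w) (a ∷ r) (suc i) (suc j) (s≤s lt) = allPairs-lookup w r i j lt

prefix-shape : ∀ {n} (w : Vec ℤ n) (us : List ℕ) (M : List ℤ) → toList w ≡ map +_ us ++ M →
               All (0 ℕ.<_) us → AllPairs ℕ._<_ us → AllPairs _<_ M →
               GrassShape (length us) w × (∀ i → toℕ i ℕ.< length us → ∃ λ u → u ∈ us × lookup w i ≡ + u)
prefix-shape w [] M e _ _ pm =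
  record { u-pos = λ i () ; u-incr = λ i j _ () ; tail-incr = λ i j _ lt → allPairs-lookup w (subst (AllPairs _<_) (sym e) pm) i j lt } ,
  λ i ()
prefix-shape (x ∷ w) (u ∷ us) M e (pu ∷ pus) (au ∷ aus) pm with prefix-shape w us M (LP.∷-injectiveʳ e) pus aus pm
... | shape , from-us = record { u-pos = pos ; u-incr = incr ; tail-incr = tail } , from-us'
  where
  open GrassShape shape
  x≡u : x ≡ + u
  x≡u = LP.∷-injectiveˡ e
  pos : ∀ i → toℕ i ℕ.< suc (length us) → + 0 < lookup (x ∷ w) i
  pos zero _ = subst (+ 0 <_) (sym x≡u) (ℤ.+<+ pu)
  pos (suc i) (s≤s lt) = u-pos i lt
  incr : ∀ i j → toℕ i ℕ.< toℕ j → toℕ j ℕ.< suc (length us) → lookup (x ∷ w) i < lookup (x ∷ w) j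
  incr zero (suc j) _ (s≤s lt) with from-us j lt
  ... | u' , m , e' = subst₂ _<_ (sym x≡u) (sym e') (ℤ.+<+ (All.lookup au m))
  incr (suc i) (suc j) (s≤s lt) (s≤s lt') = u-incr i j lt lt'
  tail : ∀ i j → suc (length us) ℕ.≤ toℕ i → toℕ i ℕ.< toℕ j → lookup (x ∷ w) i < lookup (x ∷ w) j
  tail (suc i) (suc j) (s≤s le) (s≤s lt) = tail-incr i j le lt
  from-us' : ∀ i → toℕ i ℕ.< suc (length us) → ∃ λ u' → u' ∈ (u ∷ us) × lookup (x ∷ w) i ≡ + u'
  from-us' zero _ = u , here refl , x≡u
  from-us' (suc i) (s≤s lt) with from-us i lt
  ... | u' , m , e' = u' , there m , e'

grassmannian-shape : ∀ {n} (k : ℕ) (w : Vec ℤ n) → IsGrassmannian k w → GrassShape k w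
grassmannian-shape k w (_ , us , lams , vs , lu , (pu , lku) , (pl , lkl) , (pv , lkv) , e) =
  subst (λ k' → GrassShape k' w) lu (proj₁ (prefix-shape w us M e pu (LinkP.Linked⇒AllPairs ℕP.<-trans lku) M-incr))
  where
  M : List ℤ
  M = map (λ l → - (+ l)) (reverse lams) ++ map +_ vs
  negpart : AllPairs _<_ (map (λ l → - (+ l)) (reverse lams))
  negpart = APP.map⁺ (allPairs-reverse lams (AP.map (λ lt → ℤP.neg-mono-< (ℤ.+<+ lt)) (LinkP.Linked⇒AllPairs ℕP.<-trans lkl)))
  pospart : AllPairs _<_ (map +_ vs)
  pospart = APP.map⁺ (AP.map ℤ.+<+ (LinkP.Linked⇒AllPairs ℕP.<-trans lkv))
  neg<pos : All (λ x → All (x <_) (map +_ vs)) (map (λ l → - (+ l)) (reverse lams))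
  neg<pos = AllP.map⁺ (All.universal (λ l → AllP.map⁺ (All.map (λ pv' → ℤP.≤-<-trans (ℤP.neg-≤-pos {l} {0}) (ℤ.+<+ pv')) pv)) _)
  M-incr : AllPairs _<_ M
  M-incr = APP.++⁺ negpart pospart neg<pos

sumOver-+ : ∀ {n} (f g : ℤ → ℕ) (xs : Vec ℤ n) → sumOver (λ x → f x + g x) xs ≡ sumOver f xs + sumOver g xs
sumOver-+ f g [] = refl
sumOver-+ f g (x ∷ xs) rewrite sumOver-+ f g xs = rearrange (f x) (g x) (sumOver f xs) (sumOver g xs)
  where
  rearrange : ∀ a b c d → a + b + (c + d) ≡ a + c + (b + d)
  rearrange = solve-∀

tail-eq-except : ∀ {n} {x y : ℤ} {xs ys : Vec ℤ n} (q : Fin n) → (∀ i → i ≢ suc q → lookup (y ∷ ys) i ≡ lookup (x ∷ xs) i) → ∀ i → i ≢ q → lookup ys i ≡ lookup xs i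
tail-eq-except q h i ne = h (suc i) (λ e → ne (FP.suc-injective e))

head-eq-except : ∀ {n} {x y : ℤ} {xs ys : Vec ℤ n} (q : Fin n) → (∀ i → i ≢ suc q → lookup (y ∷ ys) i ≡ lookup (x ∷ xs) i) → y ≡ x
head-eq-except q h = h zero (λ ())

tail-eq-except-head : ∀ {n} {x y : ℤ} (xs ys : Vec ℤ n) → (∀ i → i ≢ zero → lookup (y ∷ ys) i ≡ lookup (x ∷ xs) i) → ys ≡ xs
tail-eq-except-head xs ys h = vext (λ i → h (suc i) (λ ()))

sumOver-cong-at : ∀ {n} (f g : ℤ → ℕ) (zs : Vec ℤ n) → (∀ i → f (lookup zs i) ≡ g (lookup zs i)) → sumOver f zs ≡ sumOver g zs
sumOver-cong-at f g [] _ = refl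
sumOver-cong-at f g (z ∷ zs) h = cong₂ _+_ (h zero) (sumOver-cong-at f g zs (λ i → h (suc i)))

-- If xs' differs from xs in one position q (or two positions
-- p < q), then ℓ(xs) and ℓ(xs') differ only through the contributions of
-- pairs and signs involving the changed positions; the lemmas below compare
-- ℓ(xs) + e with ℓ(xs') + d given such local comparisons.
--
-- One changed position q.  The extra summands f, f' account for the pairs with
-- entries already removed from the front (needed for the induction).
ℓ-change-one : ∀ {n} (f f' : ℤ → ℕ) (xs xs' : Vec ℤ n) (q : Fin n) (e d : ℕ) →
  (∀ i → i ≢ q → lookup xs' i ≡ lookup xs i) →
  (∀ i → toℕ i ℕ.< toℕ q → f (lookup xs i) + pairInv (lookup xs i) (lookup xs q) ≡ f' (lookup xs i) + pairInv (lookup xs i) (lookup xs' q)) →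
  (∀ i → toℕ q ℕ.< toℕ i → pairInv (lookup xs q) (lookup xs i) + f (lookup xs i) ≡ pairInv (lookup xs' q) (lookup xs i) + f' (lookup xs i)) →
  f (lookup xs q) + negInv (lookup xs q) + e ≡ f' (lookup xs' q) + negInv (lookup xs' q) + d →
  sumOver f xs + ℓ xs + e ≡ sumOver f' xs' + ℓ xs' + d
ℓ-change-one f f' (β ∷ ys) (β' ∷ ys') zero e d elsewhere before after at-q rewrite tail-eq-except-head ys ys' elsewhere =
  begin
    f β + sumOver f ys + (negInv β + sumOver (pairInv β) ys + ℓ ys) + e
  ≡⟨ rearrange (f β) (sumOver f ys) (negInv β) (sumOver (pairInv β) ys) (ℓ ys) e ⟩
    (f β + negInv β + e) + (sumOver (pairInv β) ys + sumOver f ys) + ℓ ys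
  ≡⟨ cong₂ (λ u v → u + v + ℓ ys) at-q (trans (sym (sumOver-+ (pairInv β) f ys)) (trans (sumOver-cong-at (λ x → pairInv β x + f x) (λ x → pairInv β' x + f' x) ys (λ i → after (suc i) (s≤s z≤n))) (sumOver-+ (pairInv β') f' ys))) ⟩
    (f' β' + negInv β' + d) + (sumOver (pairInv β') ys + sumOver f' ys) + ℓ ys
  ≡⟨ sym (rearrange (f' β') (sumOver f' ys) (negInv β') (sumOver (pairInv β') ys) (ℓ ys) d) ⟩
    f' β' + sumOver f' ys + (negInv β' + sumOver (pairInv β') ys + ℓ ys) + d
  ∎
  where
  open ≡-Reasoning
  rearrange : ∀ a b c g s e → a + b + (c + g + s) + e ≡ (a + c + e) + (g + b) + s
  rearrange = solve-∀
ℓ-change-one f f' (c ∷ ys) (c' ∷ ys') (suc q) e d elsewhere before after at-q rewrite head-eq-except q elsewhere =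
  begin
    f c + sumOver f ys + (negInv c + sumOver (pairInv c) ys + ℓ ys) + e
  ≡⟨ rearrange (f c) (sumOver f ys) (negInv c) (sumOver (pairInv c) ys) (ℓ ys) e ⟩
    (sumOver f ys + sumOver (pairInv c) ys) + ℓ ys + (e + f c) + negInv c
  ≡⟨ cong (λ u → u + ℓ ys + (e + f c) + negInv c) (sym (sumOver-+ f (pairInv c) ys)) ⟩
    sumOver f₁ ys + ℓ ys + (e + f c) + negInv c
  ≡⟨ cong (_+ negInv c) IH ⟩
    sumOver f₁' ys' + ℓ ys' + (d + f' c) + negInv c
  ≡⟨ cong (λ u → u + ℓ ys' + (d + f' c) + negInv c) (sumOver-+ f' (pairInv c) ys') ⟩
    (sumOver f' ys' + sumOver (pairInv c) ys') + ℓ ys' + (d + f' c) + negInv c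
  ≡⟨ sym (rearrange (f' c) (sumOver f' ys') (negInv c) (sumOver (pairInv c) ys') (ℓ ys') d) ⟩
    f' c + sumOver f' ys' + (negInv c + sumOver (pairInv c) ys' + ℓ ys') + d
  ∎
  where
  open ≡-Reasoning
  rearrange : ∀ a b g h s e → a + b + (g + h + s) + e ≡ (b + h) + s + (e + a) + g
  rearrange = solve-∀
  rearrange′ : ∀ a b h → a + b + h ≡ (a + h) + b
  rearrange′ = solve-∀
  rearrange″ : ∀ a b c g h → (a + g) + b + (c + h) ≡ (a + b + c) + (h + g)
  rearrange″ = solve-∀
  f₁ f₁' : ℤ → ℕ
  f₁ y = f y + pairInv c y
  f₁' y = f' y + pairInv c y
  β : ℤ
  β = lookup ys q
  β' : ℤ
  β' = lookup ys' q
  before₁ : ∀ i → toℕ i ℕ.< toℕ q → f₁ (lookup ys i) + pairInv (lookup ys i) β ≡ f₁' (lookup ys i) + pairInv (lookup ys i) β'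
  before₁ i lt = trans (rearrange′ (f (lookup ys i)) (pairInv c (lookup ys i)) _) (trans (cong (_+ pairInv c (lookup ys i)) (before (suc i) (s≤s lt))) (sym (rearrange′ (f' (lookup ys i)) (pairInv c (lookup ys i)) _)))
  after₁ : ∀ i → toℕ q ℕ.< toℕ i → pairInv β (lookup ys i) + f₁ (lookup ys i) ≡ pairInv β' (lookup ys i) + f₁' (lookup ys i)
  after₁ i lt = trans (sym (ℕP.+-assoc (pairInv β (lookup ys i)) (f (lookup ys i)) _)) (trans (cong (_+ pairInv c (lookup ys i)) (after (suc i) (s≤s lt))) (ℕP.+-assoc (pairInv β' (lookup ys i)) (f' (lookup ys i)) _))
  at-q₁ : f₁ β + negInv β + (e + f c) ≡ f₁' β' + negInv β' + (d + f' c)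
  at-q₁ = trans (rearrange″ (f β) (negInv β) e (pairInv c β) (f c)) (trans (cong₂ _+_ at-q (before zero (s≤s z≤n))) (sym (rearrange″ (f' β') (negInv β') d (pairInv c β') (f' c))))
  IH : sumOver f₁ ys + ℓ ys + (e + f c) ≡ sumOver f₁' ys' + ℓ ys' + (d + f' c)
  IH = ℓ-change-one f₁ f₁' ys ys' q (e + f c) (d + f' c) (tail-eq-except q elsewhere) before₁ after₁ at-q₁

sumOver-change-one : ∀ {n} (g : ℤ → ℕ) (xs xs' : Vec ℤ n) (q : Fin n) → (∀ i → i ≢ q → lookup xs' i ≡ lookup xs i) →
     sumOver g xs + g (lookup xs' q) ≡ sumOver g xs' + g (lookup xs q)
sumOver-change-one g (β ∷ ys) (β' ∷ ys') zero elsewhere rewrite tail-eq-except-head ys ys' elsewhere = rearrange (g β) (sumOver g ys) (g β')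
  where
  rearrange : ∀ a b c → a + b + c ≡ c + b + a
  rearrange = solve-∀
sumOver-change-one g (c ∷ ys) (c' ∷ ys') (suc q) elsewhere rewrite head-eq-except q elsewhere =
  trans (ℕP.+-assoc (g c) (sumOver g ys) _) (trans (cong (λ z → g c + z) (sumOver-change-one g ys ys' q (tail-eq-except q elsewhere))) (sym (ℕP.+-assoc (g c) (sumOver g ys') _)))

sumOver-change-two : ∀ {n} (g : ℤ → ℕ) (xs xs' : Vec ℤ n) (p q : Fin n) → toℕ p ℕ.< toℕ q → (∀ i → i ≢ p → i ≢ q → lookup xs' i ≡ lookup xs i) →
     sumOver g xs + (g (lookup xs' p) + g (lookup xs' q)) ≡ sumOver g xs' + (g (lookup xs p) + g (lookup xs q))
sumOver-change-two g (α ∷ ys) (α' ∷ ys') zero (suc q) lt elsewhere =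
  trans (rearrange (g α) (sumOver g ys) (g α') (g (lookup ys' q)))
  (trans (cong (λ u → g α' + (u + g α)) (sumOver-change-one g ys ys' q (λ i ne → elsewhere (suc i) (λ ()) (λ e → ne (FP.suc-injective e)))))
  (sym (rearrange′ (g α') (sumOver g ys') (g α) (g (lookup ys q)))))
  where
  rearrange : ∀ a s a' b' → a + s + (a' + b') ≡ a' + ((s + b') + a)
  rearrange = solve-∀
  rearrange′ : ∀ a' s a b → a' + s + (a + b) ≡ a' + ((s + b) + a)
  rearrange′ = solve-∀
sumOver-change-two g (c ∷ ys) (c' ∷ ys') (suc p) (suc q) (s≤s lt) elsewhere rewrite elsewhere zero (λ ()) (λ ()) =
  trans (ℕP.+-assoc (g c) (sumOver g ys) _) (trans (cong (λ z → g c + z) (sumOver-change-two g ys ys' p q lt (λ i a b → elsewhere (suc i) (λ e → a (FP.suc-injective e)) (λ e → b (FP.suc-injective e))))) (sym (ℕP.+-assoc (g c) (sumOver g ys') _)))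

sumOver-change-two-eq : ∀ {n} (g : ℤ → ℕ) (xs xs' : Vec ℤ n) (p q : Fin n) → toℕ p ℕ.< toℕ q → (∀ i → i ≢ p → i ≢ q → lookup xs' i ≡ lookup xs i) →
     g (lookup xs p) + g (lookup xs q) ≡ g (lookup xs' p) + g (lookup xs' q) → sumOver g xs ≡ sumOver g xs'
sumOver-change-two-eq g xs xs' p q lt elsewhere h = ℕP.+-cancelʳ-≡ _ (sumOver g xs) (sumOver g xs') (trans (sumOver-change-two g xs xs' p q lt elsewhere) (cong (λ z → sumOver g xs' + z) h))

ℓ-change-two : ∀ {n} (xs xs' : Vec ℤ n) (p q : Fin n) → toℕ p ℕ.< toℕ q → (e d : ℕ) →
  (∀ i → i ≢ p → i ≢ q → lookup xs' i ≡ lookup xs i) →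
  (∀ i → toℕ i ℕ.< toℕ p → pairInv (lookup xs i) (lookup xs p) + pairInv (lookup xs i) (lookup xs q) ≡ pairInv (lookup xs i) (lookup xs' p) + pairInv (lookup xs i) (lookup xs' q)) →
  (∀ i → toℕ p ℕ.< toℕ i → toℕ i ℕ.< toℕ q → pairInv (lookup xs p) (lookup xs i) + pairInv (lookup xs i) (lookup xs q) ≡ pairInv (lookup xs' p) (lookup xs i) + pairInv (lookup xs i) (lookup xs' q)) →
  (∀ i → toℕ q ℕ.< toℕ i → pairInv (lookup xs p) (lookup xs i) + pairInv (lookup xs q) (lookup xs i) ≡ pairInv (lookup xs' p) (lookup xs i) + pairInv (lookup xs' q) (lookup xs i)) →
  negInv (lookup xs p) + negInv (lookup xs q) + pairInv (lookup xs p) (lookup xs q) + e ≡ negInv (lookup xs' p) + negInv (lookup xs' q) + pairInv (lookup xs' p) (lookup xs' q) + d →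
  ℓ xs + e ≡ ℓ xs' + d
ℓ-change-two (α ∷ ys) (α' ∷ ys') zero (suc q) lt e d elsewhere before between after at-pq =
  trans (rearrange (negInv α) (sumOver (pairInv α) ys) (ℓ ys) e) (trans IH (sym (rearrange (negInv α') (sumOver (pairInv α') ys') (ℓ ys') d)))
  where
  β : ℤ
  β = lookup ys q
  β' : ℤ
  β' = lookup ys' q
  rearrange : ∀ a s t e → a + s + t + e ≡ s + t + (a + e)
  rearrange = solve-∀
  rearrange′ : ∀ a b h e → a + b + h + e ≡ h + b + (a + e)
  rearrange′ = solve-∀
  IH : sumOver (pairInv α) ys + ℓ ys + (negInv α + e) ≡ sumOver (pairInv α') ys' + ℓ ys' + (negInv α' + d)
  IH = ℓ-change-one (pairInv α) (pairInv α') ys ys' q (negInv α + e) (negInv α' + d)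
         (λ i ne → elsewhere (suc i) (λ ()) (λ x → ne (FP.suc-injective x)))
         (λ i lt' → between (suc i) (s≤s z≤n) (s≤s lt'))
         (λ i lt' → trans (ℕP.+-comm (pairInv β (lookup ys i)) _) (trans (after (suc i) (s≤s lt')) (ℕP.+-comm (pairInv α' (lookup ys i)) _)))
         (trans (sym (rearrange′ (negInv α) (negInv β) (pairInv α β) e)) (trans at-pq (rearrange′ (negInv α') (negInv β') (pairInv α' β') d)))
ℓ-change-two (c ∷ ys) (c' ∷ ys') (suc p) (suc q) (s≤s lt) e d elsewhere before between after at-pq rewrite elsewhere zero (λ ()) (λ ()) =
  trans (ℕP.+-assoc (negInv c + sumOver (pairInv c) ys) (ℓ ys) e)
  (trans (cong₂ _+_ (cong (λ z → negInv c + z) (sumOver-change-two-eq (pairInv c) ys ys' p q lt elsewhere' (before zero (s≤s z≤n)))) IH)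
  (sym (ℕP.+-assoc (negInv c + sumOver (pairInv c) ys') (ℓ ys') d)))
  where
  elsewhere' : ∀ i → i ≢ p → i ≢ q → lookup ys' i ≡ lookup ys i
  elsewhere' i a b = elsewhere (suc i) (λ x → a (FP.suc-injective x)) (λ x → b (FP.suc-injective x))
  IH : ℓ ys + e ≡ ℓ ys' + d
  IH = ℓ-change-two ys ys' p q lt e d elsewhere' (λ i lt' → before (suc i) (s≤s lt')) (λ i a b → between (suc i) (s≤s a) (s≤s b)) (λ i a → after (suc i) (s≤s a)) at-pq

-- Each lemma evaluates
-- the indicators in pairInv for the relevant entries, so that the locality
-- lemmas give ℓ(w) = ℓ(w') + 1; integer entries are written ± (m + 1).
indicator-< : ∀ {x y : ℤ} → x < y → indicator (x ℤP.<? y) ≡ 1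
indicator-< h = indicator-yes _ h

indicator-≥ : ∀ {x y : ℤ} → y ≤ x → indicator (x ℤP.<? y) ≡ 0
indicator-≥ h = indicator-no _ (ℤP.≤⇒≯ h)

b1-earlier-pair : ∀ c → c ≢ + 0 → ∣ c ∣ ≢ 1 → pairInv c (- (+ 1)) ≡ pairInv c (+ 1)
b1-earlier-pair (+ zero) nz _ = ⊥-elim (nz refl)
b1-earlier-pair (+ suc zero) _ n1 = ⊥-elim (n1 refl)
b1-earlier-pair (+ suc (suc m)) _ _ rewrite indicator-< { -[1+ 0 ]} {+ suc (suc m)} -<+ | indicator-≥ { -[1+ 0 ]} { -[1+ suc m ]} (-≤- z≤n)
  | indicator-< {+ 1} {+ suc (suc m)} (+<+ (s≤s (s≤s z≤n))) | indicator-≥ {+ 1} { -[1+ suc m ]} -≤+ = refl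
b1-earlier-pair -[1+ zero ] _ n1 = ⊥-elim (n1 refl)
b1-earlier-pair -[1+ suc m ] _ _ rewrite indicator-≥ { -[1+ 0 ]} { -[1+ suc m ]} (-≤- z≤n) | indicator-< { -[1+ 0 ]} {+ suc (suc m)} -<+
  | indicator-≥ {+ 1} { -[1+ suc m ]} -≤+ | indicator-< {+ 1} {+ suc (suc m)} (+<+ (s≤s (s≤s z≤n))) = refl

b3-middle-pair : ∀ (α β c : ℤ) → β < α → (α < c ⊎ c < β) → pairInv α c + pairInv c β ≡ pairInv β c + pairInv c α
b3-middle-pair α β c βα h rewrite indicator-cong (c ℤP.<? - α) (α ℤP.<? - c) <-neg-swap <-neg-swap
                     | indicator-cong (β ℤP.<? - c) (c ℤP.<? - β) <-neg-swap <-neg-swap = go h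
  where
  rearrange : ∀ x y A B → x + A + (y + B) ≡ x + B + (y + A)
  rearrange = solve-∀
  go : (α < c ⊎ c < β) → indicator (c ℤP.<? α) + indicator (α ℤP.<? - c) + (indicator (β ℤP.<? c) + indicator (c ℤP.<? - β)) ≡ indicator (c ℤP.<? β) + indicator (c ℤP.<? - β) + (indicator (α ℤP.<? c) + indicator (α ℤP.<? - c))
  go (inj₁ αc) rewrite indicator-≥ {c} {α} (ℤP.<⇒≤ αc) | indicator-< {β} {c} (ℤP.<-trans βα αc) | indicator-≥ {c} {β} (ℤP.<⇒≤ (ℤP.<-trans βα αc)) | indicator-< αc = rearrange 0 1 (indicator (α ℤP.<? - c)) (indicator (c ℤP.<? - β))
  go (inj₂ cβ) rewrite indicator-< {c} {α} (ℤP.<-trans cβ βα) | indicator-≥ {β} {c} (ℤP.<⇒≤ cβ) | indicator-< cβ | indicator-≥ {α} {c} (ℤP.<⇒≤ (ℤP.<-trans cβ βα)) = rearrange 1 0 (indicator (α ℤP.<? - c)) (indicator (c ℤP.<? - β))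

b3-swapped-pair : ∀ (α β : ℤ) → β < α → pairInv α β ≡ suc (pairInv β α)
b3-swapped-pair α β βα rewrite indicator-< βα | indicator-≥ {α} {β} (ℤP.<⇒≤ βα) | indicator-cong (β ℤP.<? - α) (α ℤP.<? - β) <-neg-swap <-neg-swap = refl

-- B4 (w(p) = b with 0 < b < a, w(q) = -a, replaced by a and -b), where
-- b = b' + 1 and a = a' + 1: earlier entries, middle entries, and the pair (p, q).
b4-earlier-pair : ∀ a' b' m → 0 ℕ.< m → m ℕ.< suc b' → b' ℕ.< a' →
  pairInv (+ m) (+ suc b') + pairInv (+ m) -[1+ a' ] ≡ pairInv (+ m) (+ suc a') + pairInv (+ m) -[1+ b' ]
b4-earlier-pair a' b' (suc m') _ (s≤s mb) ba
  rewrite indicator-≥ {+ suc b'} {+ suc m'} (+≤+ (ℕP.<⇒≤ (s≤s mb))) | indicator-≥ {+ suc b'} { -[1+ m' ]} -≤+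
        | indicator-< { -[1+ a' ]} {+ suc m'} -<+ | indicator-< { -[1+ a' ]} { -[1+ m' ]} (-<- (ℕP.<-≤-trans mb (ℕP.<⇒≤ ba)))
        | indicator-≥ {+ suc a'} {+ suc m'} (+≤+ (ℕP.<⇒≤ (s≤s (ℕP.<-≤-trans mb (ℕP.<⇒≤ ba))))) | indicator-≥ {+ suc a'} { -[1+ m' ]} -≤+
        | indicator-< { -[1+ b' ]} {+ suc m'} -<+ | indicator-< { -[1+ b' ]} { -[1+ m' ]} (-<- mb) = refl

b4-middle-pair : ∀ a' b' c → b' ℕ.< a' → (+ suc b' < c ⊎ c < -[1+ a' ]) →
  pairInv (+ suc b') c + pairInv c -[1+ a' ] ≡ pairInv (+ suc a') c + pairInv c -[1+ b' ]
b4-middle-pair a' b' (+ zero) ba (inj₁ (+<+ ()))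
b4-middle-pair a' b' (+ suc m') ba (inj₁ (+<+ (s≤s bm)))
  rewrite indicator-≥ {+ suc m'} {+ suc b'} (+≤+ (ℕP.<⇒≤ (s≤s bm))) | indicator-≥ {+ suc m'} { -[1+ b' ]} -≤+
        | indicator-< { -[1+ a' ]} {+ suc m'} -<+ | indicator-≥ {+ suc m'} { -[1+ a' ]} -≤+
        | indicator-< { -[1+ b' ]} {+ suc m'} -<+ | indicator-≥ { -[1+ b' ]} { -[1+ m' ]} (-≤- (ℕP.<⇒≤ bm))
        | indicator-cong ( -[1+ a' ] ℤP.<? -[1+ m' ]) (+ suc m' ℤP.<? + suc a') (λ { (-<- x) → +<+ (s≤s x) }) (λ { (+<+ (s≤s x)) → -<- x })
  = rearrange (indicator (+ suc m' ℤP.<? + suc a'))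
  where
  rearrange : ∀ x → 0 + 0 + (1 + x) ≡ x + 0 + (1 + 0)
  rearrange = solve-∀
b4-middle-pair a' b' -[1+ m ] ba (inj₂ (-<- am))
  rewrite indicator-< { -[1+ m ]} {+ suc b'} -<+ | indicator-< { -[1+ m ]} { -[1+ b' ]} (-<- (ℕP.<-trans ba am))
        | indicator-≥ { -[1+ a' ]} { -[1+ m ]} (-≤- (ℕP.<⇒≤ am)) | indicator-< { -[1+ a' ]} {+ suc m} -<+
        | indicator-< { -[1+ m ]} {+ suc a'} -<+ | indicator-< { -[1+ m ]} { -[1+ a' ]} (-<- am)
        | indicator-≥ { -[1+ b' ]} { -[1+ m ]} (-≤- (ℕP.<⇒≤ (ℕP.<-trans ba am))) | indicator-< { -[1+ b' ]} {+ suc m} -<+ = refl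

b4-swapped-pair : ∀ a' b' → b' ℕ.< a' →
  negInv (+ suc b') + negInv -[1+ a' ] + pairInv (+ suc b') -[1+ a' ] + 0 ≡ negInv (+ suc a') + negInv -[1+ b' ] + pairInv (+ suc a') -[1+ b' ] + 1
b4-swapped-pair a' b' ba rewrite indicator-≥ {+ suc b'} {+ 0} (+≤+ z≤n) | indicator-≥ {+ suc a'} {+ 0} (+≤+ z≤n)
  | indicator-< { -[1+ a' ]} { -[1+ b' ]} (-<- ba) | indicator-≥ { -[1+ b' ]} { -[1+ a' ]} (-≤- (ℕP.<⇒≤ ba)) = refl

-- B2 (w(p) = -(b + 1), w(q) = b, replaced by -b and b + 1), where b = b' + 1.
b2-earlier-pair : ∀ b' c → ((Σ ℕ λ m → c ≡ + suc m × (m ℕ.< b' ⊎ suc b' ℕ.< m)) ⊎ c < -[1+ suc b' ]) →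
  pairInv c -[1+ suc b' ] + pairInv c (+ suc b') ≡ pairInv c -[1+ b' ] + pairInv c (+ suc (suc b'))
b2-earlier-pair b' .(+ suc m) (inj₁ (m , refl , inj₁ mb))
  rewrite indicator-< { -[1+ suc b' ]} {+ suc m} -<+ | indicator-< { -[1+ suc b' ]} { -[1+ m ]} (-<- (ℕP.m<n⇒m<1+n mb))
        | indicator-≥ {+ suc b'} {+ suc m} (+≤+ (s≤s (ℕP.<⇒≤ mb))) | indicator-≥ {+ suc b'} { -[1+ m ]} -≤+
        | indicator-< { -[1+ b' ]} {+ suc m} -<+ | indicator-< { -[1+ b' ]} { -[1+ m ]} (-<- mb)
        | indicator-≥ {+ suc (suc b')} {+ suc m} (+≤+ (ℕP.<⇒≤ (s≤s (ℕP.m<n⇒m<1+n mb)))) | indicator-≥ {+ suc (suc b')} { -[1+ m ]} -≤+ = refl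
b2-earlier-pair b' .(+ suc m) (inj₁ (m , refl , inj₂ bm))
  rewrite indicator-< { -[1+ suc b' ]} {+ suc m} -<+ | indicator-≥ { -[1+ suc b' ]} { -[1+ m ]} (-≤- (ℕP.<⇒≤ bm))
        | indicator-< {+ suc b'} {+ suc m} (+<+ (s≤s (ℕP.<-trans (ℕP.n<1+n b') bm))) | indicator-≥ {+ suc b'} { -[1+ m ]} -≤+
        | indicator-< { -[1+ b' ]} {+ suc m} -<+ | indicator-≥ { -[1+ b' ]} { -[1+ m ]} (-≤- (ℕP.<⇒≤ (ℕP.<-trans (ℕP.n<1+n b') bm)))
        | indicator-< {+ suc (suc b')} {+ suc m} (+<+ (s≤s bm)) | indicator-≥ {+ suc (suc b')} { -[1+ m ]} -≤+ = refl
b2-earlier-pair b' -[1+ m ] (inj₂ (-<- bm))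
  rewrite indicator-≥ { -[1+ suc b' ]} { -[1+ m ]} (-≤- (ℕP.<⇒≤ bm)) | indicator-< { -[1+ suc b' ]} {+ suc m} -<+
        | indicator-≥ {+ suc b'} { -[1+ m ]} -≤+ | indicator-< {+ suc b'} {+ suc m} (+<+ (s≤s (ℕP.<-trans (ℕP.n<1+n b') bm)))
        | indicator-≥ { -[1+ b' ]} { -[1+ m ]} (-≤- (ℕP.<⇒≤ (ℕP.<-trans (ℕP.n<1+n b') bm))) | indicator-< { -[1+ b' ]} {+ suc m} -<+
        | indicator-≥ {+ suc (suc b')} { -[1+ m ]} -≤+ | indicator-< {+ suc (suc b')} {+ suc m} (+<+ (s≤s bm)) = refl

b2-middle-pair : ∀ b' c → -[1+ suc b' ] < c → c < + suc b' →
  pairInv -[1+ suc b' ] c + pairInv c (+ suc b') ≡ pairInv -[1+ b' ] c + pairInv c (+ suc (suc b'))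
b2-middle-pair b' c h1 h2
  rewrite indicator-≥ {c} { -[1+ suc b' ]} (ℤP.<⇒≤ h1) | indicator-< {c} {+ suc (suc b')} (ℤP.<-trans h2 (+<+ (ℕP.n<1+n _)))
        | indicator-≥ {+ suc b'} {c} (ℤP.<⇒≤ h2) | indicator-< {c} {+ suc b'} h2
        | indicator-≥ {+ suc (suc b')} {c} (ℤP.<⇒≤ (ℤP.<-trans h2 (+<+ (ℕP.n<1+n _))))
        | indicator-≥ {+ suc (suc b')} { - c} (ℤP.<⇒≤ (subst (- c <_) refl (ℤP.neg-mono-< h1)))
        | indicator-cong (+ suc b' ℤP.<? - c) (c ℤP.<? -[1+ b' ]) <-neg-swap <-neg-swap
  = rearrange (indicator (c ℤP.<? -[1+ b' ]))
  where
  rearrange : ∀ x → 0 + 1 + (0 + x) ≡ x + 1 + (0 + 0)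
  rearrange = solve-∀

b2-swapped-pair : ∀ b' →
  negInv -[1+ suc b' ] + negInv (+ suc b') + pairInv -[1+ suc b' ] (+ suc b') + 0 ≡ negInv -[1+ b' ] + negInv (+ suc (suc b')) + pairInv -[1+ b' ] (+ suc (suc b')) + 1
b2-swapped-pair b' rewrite indicator-≥ {+ suc b'} {+ 0} (+≤+ z≤n) | indicator-≥ {+ suc (suc b')} {+ 0} (+≤+ z≤n)
  | indicator-≥ {+ suc b'} { -[1+ suc b' ]} -≤+ | indicator-< {+ suc b'} {+ suc (suc b')} (+<+ (ℕP.n<1+n _))
  | indicator-≥ {+ suc (suc b')} { -[1+ b' ]} -≤+ | indicator-≥ {+ suc (suc b')} {+ suc b'} (+≤+ (ℕP.n≤1+n _)) = refl

negTransp-later-pair : ∀ α β x → pairInv α x + pairInv β x ≡ pairInv (- β) x + pairInv (- α) x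
negTransp-later-pair α β x rewrite pairInv-neg β x | pairInv-neg α x = ℕP.+-comm (pairInv α x) (pairInv β x)

lookup-update-at : ∀ {n} (w : Vec ℤ n) p v → lookup (w [ p ]≔ v) p ≡ v
lookup-update-at w p v = VP.lookup∘update p w v

lookup-update-other : ∀ {n} (w : Vec ℤ n) p v i → i ≢ p → lookup (w [ p ]≔ v) i ≡ lookup w i
lookup-update-other w p v i ne = VP.lookup∘update′ ne w v

lookup-update₂-p : ∀ {n} (w : Vec ℤ n) p q v1 v2 → p ≢ q → lookup ((w [ p ]≔ v1) [ q ]≔ v2) p ≡ v1
lookup-update₂-p w p q v1 v2 ne = trans (lookup-update-other (w [ p ]≔ v1) q v2 p ne) (lookup-update-at w p v1)

lookup-update₂-q : ∀ {n} (w : Vec ℤ n) p q v1 v2 → lookup ((w [ p ]≔ v1) [ q ]≔ v2) q ≡ v2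
lookup-update₂-q w p q v1 v2 = lookup-update-at (w [ p ]≔ v1) q v2

lookup-update₂-other : ∀ {n} (w : Vec ℤ n) p q v1 v2 i → i ≢ p → i ≢ q → lookup ((w [ p ]≔ v1) [ q ]≔ v2) i ≡ lookup w i
lookup-update₂-other w p q v1 v2 i a b = trans (lookup-update-other (w [ p ]≔ v1) q v2 i b) (lookup-update-other w p v1 i a)

negAt-as-update : ∀ {n} (w : Vec ℤ n) p → reflect (negAt p) w ≡ w [ p ]≔ - lookup w p
negAt-as-update w p = vext λ i → go i (i F.≟ p)
  where
  go : ∀ i → Dec (i ≡ p) → lookup (reflect (negAt p) w) i ≡ lookup (w [ p ]≔ - lookup w p) i
  go i (yes refl) = trans (reflect-negAt-p w i) (sym (lookup-update-at w i _))
  go i (no ne) = trans (reflect-negAt-other w p i ne) (sym (lookup-update-other w p _ i ne))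

negTransp-as-update : ∀ {n} (w : Vec ℤ n) p q → p ≢ q →
                      reflect (negTransp p q) w ≡ (w [ p ]≔ - lookup w q) [ q ]≔ - lookup w p
negTransp-as-update w p q pq = vext λ i → go i (i F.≟ p) (i F.≟ q)
  where
  go : ∀ i → Dec (i ≡ p) → Dec (i ≡ q) → lookup (reflect (negTransp p q) w) i ≡ lookup ((w [ p ]≔ - lookup w q) [ q ]≔ - lookup w p) i
  go i (yes refl) _ = trans (reflect-negTransp-p w i q pq) (sym (lookup-update₂-p w i q _ _ pq))
  go i (no a) (yes refl) = trans (reflect-negTransp-q w p i pq) (sym (lookup-update₂-q w p i _ _))
  go i (no a) (no b) = trans (reflect-negTransp-other w p q i a b) (sym (lookup-update₂-other w p q _ _ i a b))

sumOver-0 : ∀ {n} (xs : Vec ℤ n) → sumOver (λ _ → 0) xs ≡ 0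
sumOver-0 [] = refl
sumOver-0 (x ∷ xs) = sumOver-0 xs

+0≡+1⇒≡suc : ∀ {a b} → a + 0 ≡ b + 1 → a ≡ suc b
+0≡+1⇒≡suc {a} {b} e = trans (sym (ℕP.+-identityʳ a)) (trans e (ℕP.+-comm b 1))

CoverByReflection : ∀ {n} → Vec ℤ n → Vec ℤ n → Set
CoverByReflection {n} w w' = Σ (Reflection n) λ t → w' ≡ reflect t w × IsInversion t w × ℓ w ≡ suc (ℓ w')

-- Such a pair is a Bruhat cover: by the exchange property, deleting a letter
-- from a reduced word of w gives a reduced word of w'.
cover-by-reflection⇒covers : ∀ {n} (w w' : Vec ℤ n) → IsSignedPerm w → IsSignedPerm w' → CoverByReflection w w' → Covers w w'
cover-by-reflection⇒covers w w' pw pw' (t , e , inv , cnt) with minimalWord w pw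
... | ws , ev , len with exchange ws t (subst (IsInversion t) (sym ev) inv)
...   | vs , sub , lv , evs =
  (ws , reduced-if-length≡ℓ ws (trans len (cong ℓ (sym ev))) , ev ,
   vs , sub , reduced-if-length≡ℓ vs (trans lvs (cong ℓ (sym evs'))) , evs') ,
  ℓ w' , hasLength-ℓ w' pw' , subst (HasLength w) cnt (hasLength-ℓ w pw)
  where
  evs' : eval vs ≡ w'
  evs' = trans evs (trans (cong (reflect t) ev) (sym e))
  lvs : length vs ≡ ℓ w'
  lvs = ℕP.suc-injective (trans lv (trans len cnt))

PairType : ∀ {n} → ℕ → Vec ℤ n → Vec ℤ n → Set
PairType k w w' = PairB1 k w w' ⊎ PairB2 k w w' ⊎ PairB3 k w w' ⊎ PairB4 k w w'

-- Each pair of type B1–B4 is w' = w·t for an inversion t of w with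
-- ℓ(w) = ℓ(w') + 1 (for w ∈ 𝒲⁽ᵏ⁾ₙ): t = negAt p for B1, transp p q for B3 and
-- negTransp p q for B2, B4; the length is counted with the locality lemmas.
module PairsAreCovers {n} (k : ℕ) (w w' : Vec ℤ n) (pw : IsSignedPerm w) (gf : GrassShape k w) where
  open GrassShape gf

  pairB1-covers : PairB1 k w w' → CoverByReflection w w'
  pairB1-covers (p , _ , wp , e) = negAt p , e1 , subst (_< + 0) (sym wp) -<+ , cnt
    where
    e1 : w' ≡ reflect (negAt p) w
    e1 = trans e (trans (cong (w [ p ]≔_) (sym (cong -_ wp))) (sym (negAt-as-update w p)))
    w'p : lookup w' p ≡ + 1
    w'p = trans (cong (λ v → lookup v p) e) (lookup-update-at w p (+ 1))
    elsewhere : ∀ i → i ≢ p → lookup w' i ≡ lookup w i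
    elsewhere i ne = trans (cong (λ v → lookup v i) e) (lookup-update-other w p (+ 1) i ne)
    before : ∀ i → toℕ i ℕ.< toℕ p → 0 + pairInv (lookup w i) (lookup w p) ≡ 0 + pairInv (lookup w i) (lookup w' p)
    before i lt rewrite wp | w'p = b1-earlier-pair (lookup w i) (entry-nonzero w pw i) (λ h → abs-distinct w pw i p (λ x → ℕP.<-irrefl (cong toℕ x) lt) (trans h (sym (cong ∣_∣ wp))))
    after : ∀ i → toℕ p ℕ.< toℕ i → pairInv (lookup w p) (lookup w i) + 0 ≡ pairInv (lookup w' p) (lookup w i) + 0
    after i lt rewrite wp | w'p = cong (_+ 0) (pairInv-neg (+ 1) (lookup w i))
    at-q : 0 + negInv (lookup w p) + 0 ≡ 0 + negInv (lookup w' p) + 1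
    at-q rewrite wp | w'p = refl
    cnt : ℓ w ≡ suc (ℓ w')
    cnt = +0≡+1⇒≡suc (subst₂ (λ a b → a + ℓ w + 0 ≡ b + ℓ w' + 1) (sumOver-0 w) (sumOver-0 w')
                              (ℓ-change-one (λ _ → 0) (λ _ → 0) w w' p 0 1 elsewhere before after at-q))

  pairB3-covers : PairB3 k w w' → CoverByReflection w w'
  pairB3-covers (_ , _ , xa , x0 , p , q , pk , wp , kq , wq , e) = transp p q , e1 , inj₁ (lt , βα) , cnt
    where
    lt : toℕ p ℕ.< toℕ q
    lt = ℕP.<-≤-trans pk kq
    e1 : w' ≡ reflect (transp p q) w
    e1 = trans e (swapAt≡reflect p q w)
    βα : lookup w q < lookup w p
    βα = subst₂ _<_ (sym wq) (sym wp) (+<+ (ℕP.∸-monoʳ-< x0 (ℕP.<⇒≤ xa)))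
    w'p : lookup w' p ≡ lookup w q
    w'p = trans (cong (λ v → lookup v p) e1) (reflect-transp-p w p q)
    w'q : lookup w' q ≡ lookup w p
    w'q = trans (cong (λ v → lookup v q) e1) (reflect-transp-q w p q)
    elsewhere : ∀ i → i ≢ p → i ≢ q → lookup w' i ≡ lookup w i
    elsewhere i a b = trans (cong (λ v → lookup v i) e1) (reflect-transp-other w p q i a b)
    mid : ∀ i → toℕ p ℕ.< toℕ i → toℕ i ℕ.< toℕ q → lookup w p < lookup w i ⊎ lookup w i < lookup w q
    mid i a b with toℕ i ℕP.<? k
    ... | yes ik = inj₁ (u-incr p i a ik)
    ... | no ik = inj₂ (tail-incr i q (ℕP.≮⇒≥ ik) b)
    before : ∀ i → toℕ i ℕ.< toℕ p → pairInv (lookup w i) (lookup w p) + pairInv (lookup w i) (lookup w q) ≡ pairInv (lookup w i) (lookup w' p) + pairInv (lookup w i) (lookup w' q)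
    before i _ rewrite w'p | w'q = ℕP.+-comm (pairInv (lookup w i) (lookup w p)) _
    between : ∀ i → toℕ p ℕ.< toℕ i → toℕ i ℕ.< toℕ q → pairInv (lookup w p) (lookup w i) + pairInv (lookup w i) (lookup w q) ≡ pairInv (lookup w' p) (lookup w i) + pairInv (lookup w i) (lookup w' q)
    between i a b rewrite w'p | w'q = b3-middle-pair (lookup w p) (lookup w q) (lookup w i) βα (mid i a b)
    after : ∀ i → toℕ q ℕ.< toℕ i → pairInv (lookup w p) (lookup w i) + pairInv (lookup w q) (lookup w i) ≡ pairInv (lookup w' p) (lookup w i) + pairInv (lookup w' q) (lookup w i)
    after i _ rewrite w'p | w'q = ℕP.+-comm (pairInv (lookup w p) (lookup w i)) _
    at-pq : negInv (lookup w p) + negInv (lookup w q) + pairInv (lookup w p) (lookup w q) + 0 ≡ negInv (lookup w' p) + negInv (lookup w' q) + pairInv (lookup w' p) (lookup w' q) + 1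
    at-pq rewrite w'p | w'q | b3-swapped-pair (lookup w p) (lookup w q) βα = rearrange (negInv (lookup w p)) (negInv (lookup w q)) (pairInv (lookup w q) (lookup w p))
      where
      rearrange : ∀ a b h → a + b + suc h + 0 ≡ b + a + h + 1
      rearrange = solve-∀
    cnt : ℓ w ≡ suc (ℓ w')
    cnt = +0≡+1⇒≡suc (ℓ-change-two w w' p q lt 0 1 elsewhere before between after at-pq)

  pos-form : ∀ {c : ℤ} → + 0 < c → c ≡ + ∣ c ∣
  pos-form h = sym (ℤP.0≤i⇒+∣i∣≡i (ℤP.<⇒≤ h))

  pairB4-covers′ : ∀ a' b' p q → b' ℕ.< a' → toℕ p ℕ.< k → lookup w p ≡ + suc b' → k ℕ.≤ toℕ q → lookup w q ≡ -[1+ a' ] →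
            w' ≡ (w [ p ]≔ + suc a') [ q ]≔ -[1+ b' ] → CoverByReflection w w'
  pairB4-covers′ a' b' p q ba pk wp kq wq e = negTransp p q , e1 , (pq , inv) , cnt
    where
    lt : toℕ p ℕ.< toℕ q
    lt = ℕP.<-≤-trans pk kq
    pq : p ≢ q
    pq x = ℕP.<-irrefl (cong toℕ x) lt
    w'p : lookup w' p ≡ + suc a'
    w'p = trans (cong (λ v → lookup v p) e) (lookup-update₂-p w p q _ _ pq)
    w'q : lookup w' q ≡ -[1+ b' ]
    w'q = trans (cong (λ v → lookup v q) e) (lookup-update₂-q w p q _ _)
    elsewhere : ∀ i → i ≢ p → i ≢ q → lookup w' i ≡ lookup w i
    elsewhere i a b = trans (cong (λ v → lookup v i) e) (lookup-update₂-other w p q _ _ i a b)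
    e1 : w' ≡ reflect (negTransp p q) w
    e1 = trans e (trans (cong₂ (λ x y → (w [ p ]≔ x) [ q ]≔ y) (sym (cong -_ wq)) (sym (cong -_ wp)))
                        (sym (negTransp-as-update w p q pq)))
    inv : lookup w p ℤ.+ lookup w q < + 0
    inv rewrite wp | wq = <-neg⇒sum<0 {+ suc b'} { -[1+ a' ]} (-<- ba)
    before : ∀ i → toℕ i ℕ.< toℕ p → pairInv (lookup w i) (lookup w p) + pairInv (lookup w i) (lookup w q) ≡ pairInv (lookup w i) (lookup w' p) + pairInv (lookup w i) (lookup w' q)
    before i lt' rewrite wp | wq | w'p | w'q | pos-form (u-pos i (ℕP.<-trans lt' pk)) =
      b4-earlier-pair a' b' _ (ℤP.drop‿+<+ (subst (+ 0 <_) (pos-form (u-pos i (ℕP.<-trans lt' pk))) (u-pos i (ℕP.<-trans lt' pk))))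
        (ℤP.drop‿+<+ (subst₂ _<_ (pos-form (u-pos i (ℕP.<-trans lt' pk))) wp (u-incr i p lt' pk))) ba
    between : ∀ i → toℕ p ℕ.< toℕ i → toℕ i ℕ.< toℕ q → pairInv (lookup w p) (lookup w i) + pairInv (lookup w i) (lookup w q) ≡ pairInv (lookup w' p) (lookup w i) + pairInv (lookup w i) (lookup w' q)
    between i a b rewrite w'p | w'q = subst₂ (λ u v → pairInv u (lookup w i) + pairInv (lookup w i) v ≡ pairInv (+ suc a') (lookup w i) + pairInv (lookup w i) -[1+ b' ]) (sym wp) (sym wq)
       (b4-middle-pair a' b' (lookup w i) ba (mid (toℕ i ℕP.<? k)))
      where
      mid : Dec (toℕ i ℕ.< k) → + suc b' < lookup w i ⊎ lookup w i < -[1+ a' ]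
      mid (yes ik) = inj₁ (subst (_< lookup w i) wp (u-incr p i a ik))
      mid (no ik) = inj₂ (subst (lookup w i <_) wq (tail-incr i q (ℕP.≮⇒≥ ik) b))
    after : ∀ i → toℕ q ℕ.< toℕ i → pairInv (lookup w p) (lookup w i) + pairInv (lookup w q) (lookup w i) ≡ pairInv (lookup w' p) (lookup w i) + pairInv (lookup w' q) (lookup w i)
    after i _ rewrite wp | wq | w'p | w'q = negTransp-later-pair (+ suc b') -[1+ a' ] (lookup w i)
    at-pq : negInv (lookup w p) + negInv (lookup w q) + pairInv (lookup w p) (lookup w q) + 0 ≡ negInv (lookup w' p) + negInv (lookup w' q) + pairInv (lookup w' p) (lookup w' q) + 1
    at-pq rewrite wp | wq | w'p | w'q = b4-swapped-pair a' b' ba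
    cnt : ℓ w ≡ suc (ℓ w')
    cnt = +0≡+1⇒≡suc (ℓ-change-two w w' p q lt 0 1 elsewhere before between after at-pq)

  pairB4-covers : PairB4 k w w' → CoverByReflection w w'
  pairB4-covers (a , x , xa , x0 , p , q , pk , wp , kq , wq , e) = go a (a ∸ x) refl (ℕP.∸-monoʳ-< x0 (ℕP.<⇒≤ xa)) (ℕP.m<n⇒0<n∸m xa) wp wq e
    where
    go : ∀ a b → b ≡ a ∸ x → b ℕ.< a → 0 ℕ.< b → lookup w p ≡ + (a ∸ x) → lookup w q ≡ - (+ a) → w' ≡ (w [ p ]≔ + a) [ q ]≔ - (+ (a ∸ x)) → CoverByReflection w w'
    go (suc a') (suc b') eb (s≤s ba) _ wp' wq' e' rewrite sym eb = pairB4-covers′ a' b' p q ba pk wp' kq wq' e'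

  pairB2-covers′ : ∀ b' p q → k ℕ.≤ toℕ p → lookup w p ≡ -[1+ suc b' ] → k ℕ.≤ toℕ q → lookup w q ≡ + suc b' →
            w' ≡ (w [ p ]≔ -[1+ b' ]) [ q ]≔ + suc (suc b') → CoverByReflection w w'
  pairB2-covers′ b' p q kp wp kq wq e = negTransp p q , e1 , (pq , inv) , cnt
    where
    lt : toℕ p ℕ.< toℕ q
    lt with ℕP.<-cmp (toℕ p) (toℕ q)
    ... | tri< l _ _ = l
    ... | tri≈ _ eq _ = ⊥-elim (neqz (trans (sym wp) (trans (cong (lookup w) (FP.toℕ-injective eq)) wq)))
      where
      neqz : -[1+ suc b' ] ≢ + suc b'
      neqz ()
    ... | tri> _ _ g = ⊥-elim (ℤP.<-asym (subst₂ _<_ (sym wp) (sym wq) -<+) (tail-incr q p kq g))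
    pq : p ≢ q
    pq x = ℕP.<-irrefl (cong toℕ x) lt
    w'p : lookup w' p ≡ -[1+ b' ]
    w'p = trans (cong (λ v → lookup v p) e) (lookup-update₂-p w p q _ _ pq)
    w'q : lookup w' q ≡ + suc (suc b')
    w'q = trans (cong (λ v → lookup v q) e) (lookup-update₂-q w p q _ _)
    elsewhere : ∀ i → i ≢ p → i ≢ q → lookup w' i ≡ lookup w i
    elsewhere i a b = trans (cong (λ v → lookup v i) e) (lookup-update₂-other w p q _ _ i a b)
    e1 : w' ≡ reflect (negTransp p q) w
    e1 = trans e (trans (cong₂ (λ x y → (w [ p ]≔ x) [ q ]≔ y) (sym (cong -_ wq)) (sym (cong -_ wp)))
                        (sym (negTransp-as-update w p q pq)))
    inv : lookup w p ℤ.+ lookup w q < + 0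
    inv rewrite wp | wq = <-neg⇒sum<0 { -[1+ suc b' ]} {+ suc b'} (+<+ (ℕP.n<1+n _))
    before : ∀ i → toℕ i ℕ.< toℕ p → pairInv (lookup w i) (lookup w p) + pairInv (lookup w i) (lookup w q) ≡ pairInv (lookup w i) (lookup w' p) + pairInv (lookup w i) (lookup w' q)
    before i lt' rewrite wp | wq | w'p | w'q = b2-earlier-pair b' (lookup w i) (side (toℕ i ℕP.<? k))
      where
      ip : i ≢ p
      ip x = ℕP.<-irrefl (cong toℕ x) lt'
      iq : i ≢ q
      iq x = ℕP.<-irrefl (cong toℕ x) (ℕP.<-trans lt' lt)
      side : Dec (toℕ i ℕ.< k) → (Σ ℕ λ m → lookup w i ≡ + suc m × (m ℕ.< b' ⊎ suc b' ℕ.< m)) ⊎ lookup w i < -[1+ suc b' ]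
      side (no ik) = inj₂ (subst (lookup w i <_) wp (tail-incr i p (ℕP.≮⇒≥ ik) lt'))
      side (yes ik) = inj₁ (go (lookup w i) refl (u-pos i ik))
        where
        go : ∀ c → c ≡ lookup w i → + 0 < c → Σ ℕ λ m → lookup w i ≡ + suc m × (m ℕ.< b' ⊎ suc b' ℕ.< m)
        go (+ zero) _ (+<+ ())
        go (+ suc m) ce _ = m , sym ce , tri (ℕP.<-cmp m b')
          where
          dq : suc m ≢ suc b'
          dq h = abs-distinct w pw i q iq (trans (cong ∣_∣ (sym ce)) (trans h (sym (cong ∣_∣ wq))))
          dp : suc m ≢ suc (suc b')
          dp h = abs-distinct w pw i p ip (trans (cong ∣_∣ (sym ce)) (trans h (sym (cong ∣_∣ wp))))
          tri : _ → m ℕ.< b' ⊎ suc b' ℕ.< m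
          tri (tri< l _ _) = inj₁ l
          tri (tri≈ _ eq _) = ⊥-elim (dq (cong suc eq))
          tri (tri> _ _ g) with ℕP.<-cmp (suc b') m
          ... | tri< l _ _ = inj₂ l
          ... | tri≈ _ eq _ = ⊥-elim (dp (cong suc (sym eq)))
          ... | tri> _ _ g' = ⊥-elim (ℕP.<-irrefl refl (ℕP.<-≤-trans g (ℕP.≤-pred g')))
    between : ∀ i → toℕ p ℕ.< toℕ i → toℕ i ℕ.< toℕ q → pairInv (lookup w p) (lookup w i) + pairInv (lookup w i) (lookup w q) ≡ pairInv (lookup w' p) (lookup w i) + pairInv (lookup w i) (lookup w' q)
    between i a b rewrite w'p | w'q = subst₂ (λ u v → pairInv u (lookup w i) + pairInv (lookup w i) v ≡ pairInv -[1+ b' ] (lookup w i) + pairInv (lookup w i) (+ suc (suc b'))) (sym wp) (sym wq)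
       (b2-middle-pair b' (lookup w i) (subst (_< lookup w i) wp (tail-incr p i kp a)) (subst (lookup w i <_) wq (tail-incr i q (ℕP.≤-trans kp (ℕP.<⇒≤ a)) b)))
    after : ∀ i → toℕ q ℕ.< toℕ i → pairInv (lookup w p) (lookup w i) + pairInv (lookup w q) (lookup w i) ≡ pairInv (lookup w' p) (lookup w i) + pairInv (lookup w' q) (lookup w i)
    after i _ rewrite wp | wq | w'p | w'q = negTransp-later-pair -[1+ suc b' ] (+ suc b') (lookup w i)
    at-pq : negInv (lookup w p) + negInv (lookup w q) + pairInv (lookup w p) (lookup w q) + 0 ≡ negInv (lookup w' p) + negInv (lookup w' q) + pairInv (lookup w' p) (lookup w' q) + 1
    at-pq rewrite wp | wq | w'p | w'q = b2-swapped-pair b'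
    cnt : ℓ w ≡ suc (ℓ w')
    cnt = +0≡+1⇒≡suc (ℓ-change-two w w' p q lt 0 1 elsewhere before between after at-pq)

  pairB2-covers : PairB2 k w w' → CoverByReflection w w'
  pairB2-covers (a , _ , p , q , kp , wp , kq , a1 , wq , e) = go a a1 wp wq e
    where
    go : ∀ a → 0 ℕ.< a ∸ 1 → lookup w p ≡ - (+ a) → lookup w q ≡ + (a ∸ 1) → w' ≡ (w [ p ]≔ - (+ (a ∸ 1))) [ q ]≔ + a → CoverByReflection w w'
    go (suc (suc b')) _ wp' wq' e' = pairB2-covers′ b' p q kp wp' kq wq' e'

  pair-covers : PairType k w w' → CoverByReflection w w'
  pair-covers (inj₁ b1) = pairB1-covers b1
  pair-covers (inj₂ (inj₁ b2)) = pairB2-covers b2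
  pair-covers (inj₂ (inj₂ (inj₁ b3))) = pairB3-covers b3
  pair-covers (inj₂ (inj₂ (inj₂ b4))) = pairB4-covers b4

negative-form : ∀ {c : ℤ} → c < + 0 → ∃ λ a' → c ≡ -[1+ a' ]
negative-form { -[1+ a' ]} _ = a' , refl
negative-form {+ _} (+<+ ())

positive-form : ∀ {c : ℤ} → + 0 < c → ∃ λ b' → c ≡ + suc b'
positive-form {+ suc b'} _ = b' , refl
positive-form {+ zero} (+<+ ())
positive-form { -[1+ _ ]} ()

abs-cases : ∀ (c : ℤ) m → ∣ c ∣ ≡ suc m → c ≡ + suc m ⊎ c ≡ -[1+ m ]
abs-cases (+ x) m refl = inj₁ refl
abs-cases -[1+ x ] m refl = inj₂ refl

abs-exists-below : ∀ {n} (w : Vec ℤ n) → IsSignedPerm w → ∀ p c → ∣ lookup w p ∣ ≡ suc (suc c) → ∃ λ r → ∣ lookup w r ∣ ≡ suc c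
abs-exists-below {n} w pw p c e with abs-range w pw p
... | k0 , k0<n , ek0 = abs-exists w pw c (ℕP.<-trans (ℕP.n<1+n c) (subst (ℕ._< n) (sym (ℕP.suc-injective (trans (sym e) ek0))) k0<n))

-[1+]≢+ : ∀ {a b} → -[1+ a ] ≢ + b
-[1+]≢+ ()

-- Conversely, let w, w' ∈ 𝒲⁽ᵏ⁾ₙ with w' = w·t for an inversion t of w and
-- ℓ(w) = ℓ(w') + 1.  Each shape of t either gives one of B1–B4, or is ruled
-- out: because w' would violate the increasing order of its tail, or because
-- w' is reached from w by three successive inversions, so ℓ(w) ≥ ℓ(w') + 3.
module CoversArePairs {n} (k : ℕ) (w w' : Vec ℤ n) (pw : IsSignedPerm w) (pw' : IsSignedPerm w')
                      (gf : GrassShape k w) (gf' : GrassShape k w') (len : ℓ w ≡ suc (ℓ w')) where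
  open GrassShape gf
  module G' = GrassShape gf'

  no-three-step-descent : ∀ t1 t2 t3 → IsInversion t1 w → IsInversion t2 (reflect t1 w) →
                          IsInversion t3 (reflect t2 (reflect t1 w)) → reflect t3 (reflect t2 (reflect t1 w)) ≡ w' → ⊥
  no-three-step-descent t1 t2 t3 h1 h2 h3 e with inversion-lowers-ℓ t1 w h1 pw
  ... | s1 , p1 with inversion-lowers-ℓ t2 _ h2 p1
  ... | s2 , p2 with inversion-lowers-ℓ t3 _ h3 p2
  ... | s3 , _ = ℕP.1+n≰n (ℕP.≤-trans (ℕP.n≤1+n _) (ℕP.≤-pred (subst₂ ℕ._≤_ (cong (λ z → suc (suc (suc (ℓ z)))) e) len three-steps)))
    where
    three-steps : suc (suc (suc (ℓ (reflect t3 (reflect t2 (reflect t1 w)))))) ℕ.≤ ℓ w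
    three-steps = ℕP.≤-trans (s≤s (s≤s s3)) (ℕP.≤-trans (s≤s s2) s1)

  negative⇒tail : ∀ r → lookup w r < + 0 → k ℕ.≤ toℕ r
  negative⇒tail r neg with toℕ r ℕP.<? k
  ... | yes rk = ⊥-elim (ℤP.<-asym neg (u-pos r rk))
  ... | no nrk = ℕP.≮⇒≥ nrk

  same-position : ∀ {r p x y} → lookup w r ≡ x → lookup w p ≡ y → toℕ r ≡ toℕ p → x ≡ y
  same-position wr wp eq = trans (sym wr) (trans (cong (lookup w) (FP.toℕ-injective eq)) wp)

  -- t = negAt p with w(p) = -(c + 2): the entry ±(c + 1) of w at some r gives a contradiction.
  module NegAtDeep (c : ℕ) (p : Fin n) (kp : k ℕ.≤ toℕ p) (wp : lookup w p ≡ -[1+ suc c ])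
                   (e : w' ≡ reflect (negAt p) w) where
    w'p : lookup w' p ≡ + suc (suc c)
    w'p = trans (cong (λ v → lookup v p) e) (trans (reflect-negAt-p w p) (cong -_ wp))
    w'o : ∀ i → i ≢ p → lookup w' i ≡ lookup w i
    w'o i ne = trans (cong (λ v → lookup v i) e) (reflect-negAt-other w p i ne)

    tail-entry : ∀ r x → k ℕ.≤ toℕ r → lookup w r ≡ x → -[1+ suc c ] < x → x < + suc (suc c) → ⊥
    tail-entry r x kr wr lo hi with ℕP.<-cmp (toℕ r) (toℕ p)
    ... | tri< rp _ _ = ℤP.<-asym (subst₂ _<_ (sym wp) (sym wr) lo) (tail-incr r p kr rp)
    ... | tri≈ _ eq _ = ℤP.<-irrefl (same-position wp wr (sym eq)) lo
    ... | tri> _ _ pr = ℤP.<-asym (subst₂ _<_ (sym (trans (w'o r (λ x → <⇒≢ pr (sym x))) wr)) (sym w'p) hi) (G'.tail-incr p r kp pr)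

    -- the entry c + 1 among the u's: w →(negTransp r p) →(negAt p) →(transp r p) w'
    u-entry : ∀ r → toℕ r ℕ.< k → lookup w r ≡ + suc c → ⊥
    u-entry r rk wr = no-three-step-descent (negTransp r p) (negAt p) (transp r p) h1 h2 h3 eqv
      where
      rp : toℕ r ℕ.< toℕ p
      rp = ℕP.<-≤-trans rk kp
      r≢p : r ≢ p
      r≢p = <⇒≢ rp
      x1 : Vec ℤ n
      x1 = reflect (negTransp r p) w
      x2 : Vec ℤ n
      x2 = reflect (negAt p) x1
      x1r : lookup x1 r ≡ + suc (suc c)
      x1r = trans (reflect-negTransp-p w r p r≢p) (cong -_ wp)
      x1p : lookup x1 p ≡ -[1+ c ]
      x1p = trans (reflect-negTransp-q w r p r≢p) (cong -_ wr)
      x2p : lookup x2 p ≡ + suc c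
      x2p = trans (reflect-negAt-p x1 p) (cong -_ x1p)
      h1 : IsInversion (negTransp r p) w
      h1 = r≢p , subst₂ (λ a b → a ℤ.+ b < + 0) (sym wr) (sym wp) (<-neg⇒sum<0 {+ suc c} { -[1+ suc c ]} (-<- (ℕP.n<1+n c)))
      h2 : IsInversion (negAt p) x1
      h2 = subst (_< + 0) (sym x1p) -<+
      h3 : IsInversion (transp r p) x2
      h3 = inj₁ (rp , subst₂ _<_ (sym x2p) (sym (trans (reflect-negAt-other x1 p r r≢p) x1r)) (+<+ (ℕP.n<1+n _)))
      eqv : reflect (transp r p) x2 ≡ w'
      eqv = vext λ i → go i (i F.≟ r) (i F.≟ p)
        where
        go : ∀ i → Dec (i ≡ r) → Dec (i ≡ p) → lookup (reflect (transp r p) x2) i ≡ lookup w' i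
        go i (yes refl) _ = trans (reflect-transp-p x2 i p) (trans x2p (sym (trans (w'o i r≢p) wr)))
        go i (no a) (yes refl) = trans (reflect-transp-q x2 r i) (trans (reflect-negAt-other x1 i r r≢p) (trans x1r (sym w'p)))
        go i (no a) (no b) = trans (reflect-transp-other x2 r p i a b)
          (trans (reflect-negAt-other x1 p i b) (trans (reflect-negTransp-other w r p i a b) (sym (w'o i b))))

    not-cover : ⊥
    not-cover with abs-exists-below w pw p c (cong ∣_∣ wp)
    ... | r , er with abs-cases (lookup w r) c er
    ... | inj₂ wr = tail-entry r _ (negative⇒tail r (subst (_< + 0) (sym wr) -<+)) wr (-<- (ℕP.n<1+n c)) -<+
    ... | inj₁ wr with toℕ r ℕP.<? k
    ...   | yes rk = u-entry r rk wr
    ...   | no nrk = tail-entry r _ (ℕP.≮⇒≥ nrk) wr -<+ (+<+ (ℕP.n<1+n _))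

  caseNegAt : ∀ p → lookup w p < + 0 → w' ≡ reflect (negAt p) w → PairType k w w'
  caseNegAt p wp e with negative-form wp
  ... | zero , wpe = inj₁ (p , negative⇒tail p wp , wpe , trans e (trans (negAt-as-update w p) (cong (w [ p ]≔_) (cong -_ wpe))))
  ... | suc c , wpe = ⊥-elim (NegAtDeep.not-cover c p (negative⇒tail p wp) wpe e)

  caseTransp : ∀ p q → toℕ p ℕ.< toℕ q → lookup w q < lookup w p → w' ≡ reflect (transp p q) w → PairType k w w'
  caseTransp p q lt qp e with toℕ q ℕP.<? k
  ... | yes qk = ⊥-elim (ℤP.<-asym qp (u-incr p q lt qk))
  ... | no nqk with toℕ p ℕP.<? k
  ...   | no npk = ⊥-elim (ℤP.<-asym qp (tail-incr p q (ℕP.≮⇒≥ npk) lt))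
  ...   | yes pk with positive-form (subst (+ 0 <_) (trans (cong (λ v → lookup v p) e) (reflect-transp-p w p q)) (G'.u-pos p pk))
                    | positive-form (u-pos p pk)
  ...     | b' , wq | a' , wp =
    inj₂ (inj₂ (inj₁ (suc a' , suc a' ∸ suc b' , ℕP.∸-monoʳ-< (s≤s z≤n) (ℕP.<⇒≤ ba) , ℕP.m<n⇒0<n∸m ba ,
                      p , q , pk , wp , ℕP.≮⇒≥ nqk , wq' , trans e (sym (swapAt≡reflect p q w)))))
    where
    ba : suc b' ℕ.< suc a'
    ba = ℤP.drop‿+<+ (subst₂ _<_ wq wp qp)
    wq' : lookup w q ≡ + (suc a' ∸ (suc a' ∸ suc b'))
    wq' = trans wq (cong +_ (sym (ℕP.m∸[m∸n]≡n (ℕP.<⇒≤ ba))))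

  -- t = negTransp p q with both entries negative: w →(negAt p) →(transp p q) →(negAt p) w'.
  negTransp-both-negative : ∀ p q a' b' → toℕ p ℕ.< toℕ q → lookup w p ≡ -[1+ a' ] → lookup w q ≡ -[1+ b' ] →
                            w' ≡ reflect (negTransp p q) w → ⊥
  negTransp-both-negative p q a' b' lt wp wq e = no-three-step-descent (negAt p) (transp p q) (negAt p) h1 h2 h3 eqv
    where
    p≢q : p ≢ q
    p≢q = <⇒≢ lt
    x1 : Vec ℤ n
    x1 = reflect (negAt p) w
    x2 : Vec ℤ n
    x2 = reflect (transp p q) x1
    x1p : lookup x1 p ≡ + suc a'
    x1p = trans (reflect-negAt-p w p) (cong -_ wp)
    x1q : lookup x1 q ≡ -[1+ b' ]
    x1q = trans (reflect-negAt-other w p q (λ x → p≢q (sym x))) wq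
    x2p : lookup x2 p ≡ -[1+ b' ]
    x2p = trans (reflect-transp-p x1 p q) x1q
    h1 : IsInversion (negAt p) w
    h1 = subst (_< + 0) (sym wp) -<+
    h2 : IsInversion (transp p q) x1
    h2 = inj₁ (lt , subst₂ _<_ (sym x1q) (sym x1p) -<+)
    h3 : IsInversion (negAt p) x2
    h3 = subst (_< + 0) (sym x2p) -<+
    eqv : reflect (negAt p) x2 ≡ w'
    eqv = vext λ i → go i (i F.≟ p) (i F.≟ q)
      where
      w'i : ∀ i → lookup w' i ≡ lookup (reflect (negTransp p q) w) i
      w'i = λ i → cong (λ v → lookup v i) e
      go : ∀ i → Dec (i ≡ p) → Dec (i ≡ q) → lookup (reflect (negAt p) x2) i ≡ lookup w' i
      go i (yes refl) _ = trans (reflect-negAt-p x2 i) (trans (cong -_ x2p)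
        (sym (trans (w'i i) (trans (reflect-negTransp-p w i q p≢q) (cong -_ wq)))))
      go i (no a) (yes refl) = trans (reflect-negAt-other x2 p i a) (trans (reflect-transp-q x1 p i) (trans x1p
        (sym (trans (w'i i) (trans (reflect-negTransp-q w p i p≢q) (cong -_ wp))))))
      go i (no a) (no b) = trans (reflect-negAt-other x2 p i a) (trans (reflect-transp-other x1 p q i a b)
        (trans (reflect-negAt-other w p i a) (sym (trans (w'i i) (reflect-negTransp-other w p q i a b)))))

  -- t = negTransp p q in the tail with w(p) = -(d' + 2) and w(q) = b' + 1, b' < d':
  -- the entry ±(d' + 1) of w at some r gives a contradiction.
  module NegTranspDeep (p q : Fin n) (b' d' : ℕ) (lt : toℕ p ℕ.< toℕ q) (kp : k ℕ.≤ toℕ p) (kq : k ℕ.≤ toℕ q)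
                       (wp : lookup w p ≡ -[1+ suc d' ]) (wq : lookup w q ≡ + suc b') (bd : b' ℕ.< d')
                       (e : w' ≡ reflect (negTransp p q) w) where
    p≢q : p ≢ q
    p≢q = <⇒≢ lt
    w'p : lookup w' p ≡ -[1+ b' ]
    w'p = trans (cong (λ v → lookup v p) e) (trans (reflect-negTransp-p w p q p≢q) (cong -_ wq))
    w'q : lookup w' q ≡ + suc (suc d')
    w'q = trans (cong (λ v → lookup v q) e) (trans (reflect-negTransp-q w p q p≢q) (cong -_ wp))
    w'o : ∀ i → i ≢ p → i ≢ q → lookup w' i ≡ lookup w i
    w'o i a b = trans (cong (λ v → lookup v i) e) (reflect-negTransp-other w p q i a b)

    negative-entry : ∀ r → lookup w r ≡ -[1+ d' ] → ⊥
    negative-entry r wr with ℕP.<-cmp (toℕ r) (toℕ p)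
    ... | tri< rp _ _ = ℤP.<-asym (subst₂ _<_ (sym wp) (sym wr) (-<- (ℕP.n<1+n d')))
                                  (tail-incr r p (negative⇒tail r (subst (_< + 0) (sym wr) -<+)) rp)
    ... | tri≈ _ eq _ = ℕP.<-irrefl (ℤP.-[1+-injective (same-position wr wp eq)) (ℕP.n<1+n d')
    ... | tri> _ _ pr with ℕP.<-cmp (toℕ r) (toℕ q)
    ...   | tri> _ _ qr = ℤP.<-asym (subst₂ _<_ (sym wr) (sym wq) -<+) (tail-incr q r kq qr)
    ...   | tri≈ _ eq _ = -[1+]≢+ (same-position wr wq eq)
    ...   | tri< rq _ _ = ℕP.<-irrefl refl (ℕP.<-trans bd (ℤP.drop‿-<-
                            (subst₂ _<_ w'p (trans (w'o r (λ x → <⇒≢ pr (sym x)) (<⇒≢ rq)) wr) (G'.tail-incr p r kp pr))))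

    positive-tail-entry : ∀ r → k ℕ.≤ toℕ r → lookup w r ≡ + suc d' → ⊥
    positive-tail-entry r kr wr with ℕP.<-cmp (toℕ r) (toℕ q)
    ... | tri< rq _ _ = ℕP.<-irrefl refl (ℕP.<-trans bd (ℕP.≤-pred (ℤP.drop‿+<+ (subst₂ _<_ wr wq (tail-incr r q kr rq)))))
    ... | tri≈ _ eq _ = ℕP.<-irrefl (sym (ℕP.suc-injective (ℤP.+-injective (same-position wr wq eq)))) bd
    ... | tri> _ _ qr = ℕP.<-asym (ℤP.drop‿+<+ (subst₂ _<_ w'q
                          (trans (w'o r (λ x → <⇒≢ (ℕP.<-trans lt qr) (sym x)) (λ x → <⇒≢ qr (sym x))) wr) (G'.tail-incr q r kq qr)))
                          (ℕP.n<1+n (suc d'))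

    -- the entry d' + 1 among the u's: w →(transp r q) →(negTransp r p) →(transp r q) w'
    positive-u-entry : ∀ r → toℕ r ℕ.< k → lookup w r ≡ + suc d' → ⊥
    positive-u-entry r rk wr = no-three-step-descent (transp r q) (negTransp r p) (transp r q) h1 h2 h3 eqv
      where
      rp : toℕ r ℕ.< toℕ p
      rp = ℕP.<-≤-trans rk kp
      rq : toℕ r ℕ.< toℕ q
      rq = ℕP.<-trans rp lt
      r≢p : r ≢ p
      r≢p = <⇒≢ rp
      r≢q : r ≢ q
      r≢q = <⇒≢ rq
      x1 : Vec ℤ n
      x1 = reflect (transp r q) w
      x2 : Vec ℤ n
      x2 = reflect (negTransp r p) x1
      x1r : lookup x1 r ≡ + suc b'
      x1r = trans (reflect-transp-p w r q) wq
      x1q : lookup x1 q ≡ + suc d'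
      x1q = trans (reflect-transp-q w r q) wr
      x1p : lookup x1 p ≡ -[1+ suc d' ]
      x1p = trans (reflect-transp-other w r q p (λ x → r≢p (sym x)) p≢q) wp
      x2r : lookup x2 r ≡ + suc (suc d')
      x2r = trans (reflect-negTransp-p x1 r p r≢p) (cong -_ x1p)
      x2p : lookup x2 p ≡ -[1+ b' ]
      x2p = trans (reflect-negTransp-q x1 r p r≢p) (cong -_ x1r)
      x2q : lookup x2 q ≡ + suc d'
      x2q = trans (reflect-negTransp-other x1 r p q (λ x → r≢q (sym x)) (λ x → p≢q (sym x))) x1q
      h1 : IsInversion (transp r q) w
      h1 = inj₁ (rq , subst₂ _<_ (sym wq) (sym wr) (+<+ (s≤s bd)))
      h2 : IsInversion (negTransp r p) x1
      h2 = r≢p , subst₂ (λ u v → u ℤ.+ v < + 0) (sym x1r) (sym x1p)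
                   (<-neg⇒sum<0 {+ suc b'} { -[1+ suc d' ]} (-<- (ℕP.<-trans bd (ℕP.n<1+n d'))))
      h3 : IsInversion (transp r q) x2
      h3 = inj₁ (rq , subst₂ _<_ (sym x2q) (sym x2r) (+<+ (ℕP.n<1+n _)))
      eqv : reflect (transp r q) x2 ≡ w'
      eqv = vext λ i → go i (i F.≟ r) (i F.≟ q) (i F.≟ p)
        where
        go : ∀ i → Dec (i ≡ r) → Dec (i ≡ q) → Dec (i ≡ p) → lookup (reflect (transp r q) x2) i ≡ lookup w' i
        go i (yes refl) _ _ = trans (reflect-transp-p x2 i q) (trans x2q (sym (trans (w'o i r≢p r≢q) wr)))
        go i (no a) (yes refl) _ = trans (reflect-transp-q x2 r i) (trans x2r (sym w'q))
        go i (no a) (no b) (yes refl) = trans (reflect-transp-other x2 r q i a b) (trans x2p (sym w'p))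
        go i (no a) (no b) (no c) = trans (reflect-transp-other x2 r q i a b)
          (trans (reflect-negTransp-other x1 r p i a c) (trans (reflect-transp-other w r q i a b) (sym (w'o i c b))))

    not-cover : ⊥
    not-cover with abs-exists-below w pw p d' (cong ∣_∣ wp)
    ... | r , er with abs-cases (lookup w r) d' er
    ... | inj₂ wr = negative-entry r wr
    ... | inj₁ wr with toℕ r ℕP.<? k
    ...   | yes rk = positive-u-entry r rk wr
    ...   | no nrk = positive-tail-entry r (ℕP.≮⇒≥ nrk) wr

  caseNegTransp : ∀ p q → toℕ p ℕ.< toℕ q → lookup w p ℤ.+ lookup w q < + 0 → w' ≡ reflect (negTransp p q) w → PairType k w w'
  caseNegTransp p q lt sm e = by-blocks (toℕ q ℕP.<? k) (toℕ p ℕP.<? k)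
    where
    p≢q : p ≢ q
    p≢q = <⇒≢ lt
    update-form : ∀ {x y} → lookup w p ≡ - x → lookup w q ≡ - y → w' ≡ (w [ p ]≔ y) [ q ]≔ x
    update-form {x} {y} wp wq = trans e (trans (negTransp-as-update w p q p≢q)
      (cong₂ (λ a b → (w [ p ]≔ a) [ q ]≔ b) (trans (cong -_ wq) (ℤP.neg-involutive y)) (trans (cong -_ wp) (ℤP.neg-involutive x))))
    by-blocks : Dec (toℕ q ℕ.< k) → Dec (toℕ p ℕ.< k) → PairType k w w'
    by-blocks (yes qk) _ with positive-form (u-pos p (ℕP.<-trans lt qk)) | positive-form (u-pos q qk)
    ... | a' , wp | b' , wq = ⊥-elim (positive-sum (subst₂ (λ u v → u ℤ.+ v < + 0) wp wq sm))
      where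
      positive-sum : ¬ (+ suc a' ℤ.+ + suc b' < + 0)
      positive-sum (+<+ ())
    by-blocks (no nqk) (yes pk) with positive-form (u-pos p pk)
    ... | b' , wp with negative-form (ℤP.<-trans (subst (lookup w q <_) (cong -_ wp) (sum<0⇒<-neg sm)) (-<+ {b'} {0}))
    ...   | a' , wq = inj₂ (inj₂ (inj₂ (suc a' , x , xa , x0 , p , q , pk , wp' , ℕP.≮⇒≥ nqk , wq ,
                         update-form { - (+ (suc a' ∸ x))} {+ suc a'} (trans wp' (sym (ℤP.neg-involutive _))) wq)))
      where
      ba : b' ℕ.< a'
      ba = ℤP.drop‿-<- (subst₂ _<_ wq (cong -_ wp) (sum<0⇒<-neg sm))
      x : ℕ
      x = suc a' ∸ suc b'
      xa : x ℕ.< suc a'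
      xa = ℕP.∸-monoʳ-< (s≤s z≤n) (ℕP.<⇒≤ (s≤s ba))
      x0 : 0 ℕ.< x
      x0 = ℕP.m<n⇒0<n∸m (s≤s ba)
      wp' : lookup w p ≡ + (suc a' ∸ x)
      wp' = trans wp (cong +_ (sym (ℕP.m∸[m∸n]≡n (ℕP.<⇒≤ (s≤s ba)))))
    by-blocks (no nqk) (no npk) with ℤP.<-cmp (lookup w q) (+ 0)
    ... | tri< qneg _ _ with negative-form qneg | negative-form (ℤP.<-trans (tail-incr p q (ℕP.≮⇒≥ npk) lt) qneg)
    ...   | b' , wq | a' , wp = ⊥-elim (negTransp-both-negative p q a' b' lt wp wq e)
    by-blocks (no nqk) (no npk) | tri≈ _ q0 _ = ⊥-elim (entry-nonzero w pw q q0)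
    by-blocks (no nqk) (no npk) | tri> _ _ qpos with positive-form qpos
    ... | b' , wq with negative-form (ℤP.<-trans (subst (lookup w p <_) (cong -_ wq) (sum<0⇒<-negˡ sm)) (-<+ {b'} {0}))
    ...   | a' , wp with ℕP.<-cmp (suc b') a'
    ...     | tri≈ _ eq _ rewrite sym eq =
      inj₂ (inj₁ (suc (suc b') , s≤s z≤n , p , q , ℕP.≮⇒≥ npk , wp , ℕP.≮⇒≥ nqk , s≤s z≤n , wq ,
            update-form {+ suc (suc b')} { -[1+ b' ]} wp wq))
    ...     | tri> _ _ g = ⊥-elim (ℕP.<-irrefl refl (ℕP.<-≤-trans g (ℤP.drop‿-<- (subst₂ _<_ wp (cong -_ wq) (sum<0⇒<-negˡ sm)))))
    ...     | tri< l _ _ = ⊥-elim (deep a' wp l)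
      where
      deep : ∀ a' → lookup w p ≡ -[1+ a' ] → suc b' ℕ.< a' → ⊥
      deep (suc d') wp (s≤s bd) = NegTranspDeep.not-cover p q b' d' lt (ℕP.≮⇒≥ npk) (ℕP.≮⇒≥ nqk) wp wq bd e

  classify : InversionReflection w w' → PairType k w w'
  classify (byNegAt p h e) = caseNegAt p h e
  classify (byTransp p q lt h e) = caseTransp p q lt h e
  classify (byNegTransp p q lt h e) = caseNegTransp p q lt h e

-- A Bruhat cover of signed permutations is multiplication by a reflection
-- lowering the length by one: the reduced subword misses exactly one letter.
covers⇒reflection : ∀ {n} (w w' : Vec ℤ n) → IsSignedPerm w → IsSignedPerm w' → Covers w w' →
                    ℓ w ≡ suc (ℓ w') × Σ (Reflection n) λ t → w' ≡ reflect t w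
covers⇒reflection w w' pw pw' ((ws , red , ev , vs , sub , redv , evv) , m , hl' , hl)
  with split-deleted sub length-drop
  where
  length-drop : length ws ≡ suc (length vs)
  length-drop = begin
    length ws       ≡⟨ hasLength⇒≡ℓ w (length ws) (ws , red , ev , refl) pw ⟩
    ℓ w             ≡⟨ hasLength⇒≡ℓ w (suc m) hl pw ⟨
    suc m           ≡⟨ cong suc (hasLength⇒≡ℓ w' m hl' pw') ⟩
    suc (ℓ w')      ≡⟨ cong suc (hasLength⇒≡ℓ w' (length vs) (vs , redv , evv , refl) pw') ⟨
    suc (length vs) ∎
    where open ≡-Reasoning
... | a , g , b , ews , evs =
  trans (sym (hasLength⇒≡ℓ w (suc m) hl pw)) (cong suc (hasLength⇒≡ℓ w' m hl' pw')) ,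
  conjByWord b (genReflection g) ,
  trans (sym evv) (trans (cong eval evs) (trans (deletion-is-reflection a g b)
    (cong (reflect (conjByWord b (genReflection g))) (trans (cong eval (sym ews)) ev))))

mainTheorem1 : (n k : ℕ) → 1 ℕ.≤ n → k ℕ.≤ n → (w w' : OneLine n) →
    IsGrassmannian k w → IsGrassmannian k w' →
    Covers w w' ⇔ (PairB1 k w w' ⊎ PairB2 k w w' ⊎ PairB3 k w w' ⊎ PairB4 k w w')
mainTheorem1 n k _ _ w w' gw gw' = mk⇔ cover⇒pair pair⇒cover
  where
  pw : IsSignedPerm w
  pw = proj₁ gw
  pw' : IsSignedPerm w'
  pw' = proj₁ gw'
  shape : GrassShape k w
  shape = grassmannian-shape k w gw
  shape' : GrassShape k w'
  shape' = grassmannian-shape k w' gw'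

  cover⇒pair : Covers w w' → PairType k w w'
  cover⇒pair cov with covers⇒reflection w w' pw pw' cov
  ... | len , t , e = CoversArePairs.classify k w w' pw pw' shape shape' len (ToInversion.asInversion w w' pw pw' len t e)

  pair⇒cover : PairType k w w' → Covers w w'
  pair⇒cover pair = cover-by-reflection⇒covers w w' pw pw' (PairsAreCovers.pair-covers k w w' pw shape pair)
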